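{- Let $D$ be a digraph with $\vec{\Delta}(D)=k$. If $\vec{\chi}(D)=k+1$, then for every total ordering $\prec$ of $V(D)$ with $\Delta(D^{\prec})=k$, the graph $D^{\prec}$ has a connected component which is an odd cycle if $k=2$, or the complete graph $K_{k+1}$ if $k\neq 2$.
   Context: Digraphs are finite with no loops and at most one arc from $u$ to $v$ for distinct $u,v$. For a total ordering $\prec$ of $V(D)$, the backedge graph $D^{\prec}$ is the undirected graph on $V(D)$ whose edges are the pairs $\{u,v\}$ with $(u,v)\in A(D)$ and $v\prec u$; the degreewidth is $\vec{\Delta}(D)=\min_{\prec}\Delta(D^{\prec})$ over all total orderings. The dichromatic number $\vec{\chi}(D)$ is the minimum number of sets in a partition of $V(D)$ into sets each inducing an acyclic subdigraph (equivalently, $\min_{\prec}\chi(D^{\prec})$). -}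

module Defs where

open import Data.Nat using (ℕ; zero; suc; _+_; _*_; _⊔_; _<ᵇ_; _%_; _≤_)
open import Data.Bool using (Bool; true; false; _∧_; _∨_; if_then_else_; not)
open import Data.Fin using (Fin; toℕ; zero; suc; inject₁; fromℕ; _≟_)
open import Data.Fin.Permutation using (Permutation′; _⟨$⟩ʳ_)
open import Data.List using (List; map; foldr; allFin)
open import Data.Nat.ListAction using (sum)
open import Data.Product using (Σ; ∃; ∃-syntax; _×_; _,_)
open import Relation.Binary.PropositionalEquality using (_≡_; _≢_)
open import Relation.Nullary using (¬_)
open import Relation.Nullary.Decidable using (⌊_⌋)
open import Function.Definitions using (Injective)

-- A digraph on vertex set Fin n: arc relation given as a Boolean matrix,
-- loopless.  "At most one arc from u to v" is automatic.
record Digraph : Set where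
  field
    n        : ℕ
    arc      : Fin n → Fin n → Bool
    loopless : ∀ v → arc v v ≡ false
open Digraph public

-- A total ordering of V(D) = Fin n is given by a bijection pos : Fin n → Fin n
-- (position of a vertex); u ≺ v iff pos u < pos v.
Ordering : Digraph → Set
Ordering D = Permutation′ (n D)

before : (D : Digraph) → Ordering D → Fin (n D) → Fin (n D) → Bool
before D σ u v = toℕ (σ ⟨$⟩ʳ u) <ᵇ toℕ (σ ⟨$⟩ʳ v)

-- Undirected graphs on Fin m: symmetric Boolean adjacency (we only use the
-- adjacency function; symmetry holds for all graphs we build).
Graph : ℕ → Set
Graph m = Fin m → Fin m → Bool

backedge : (D : Digraph) → Ordering D → Graph (n D)
backedge D σ u v =
  (arc D u v ∧ before D σ v u) ∨ (arc D v u ∧ before D σ u v)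

degree : {m : ℕ} → Graph m → Fin m → ℕ
degree {m} G v = sum (map (λ u → if G v u then 1 else 0) (allFin m))

maxDegree : {m : ℕ} → Graph m → ℕ
maxDegree {m} G = foldr _⊔_ 0 (map (degree G) (allFin m))

Degreewidth≡ : Digraph → ℕ → Set
Degreewidth≡ D k =
  (Σ (Ordering D) λ σ → maxDegree (backedge D σ) ≡ k) ×
  (∀ (σ : Ordering D) → k ≤ maxDegree (backedge D σ))

-- A directed cycle of D all of whose vertices satisfy S: distinct vertices
-- f 0, …, f (l+1) (length l+2 ≥ 2) with arcs f i → f (i+1) and f (l+1) → f 0.
record DirCycleIn (D : Digraph) (S : Fin (n D) → Set) : Set where
  field
    len    : ℕ
    vtx    : Fin (suc (suc len)) → Fin (n D)
    inj    : Injective _≡_ _≡_ vtx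
    inS    : ∀ i → S (vtx i)
    step   : ∀ (i : Fin (suc len)) → arc D (vtx (inject₁ i)) (vtx (suc i)) ≡ true
    close  : arc D (vtx (fromℕ (suc len))) (vtx zero) ≡ true

-- A partition of V(D) into m sets (given by a colouring c : V → Fin m),
-- each inducing an acyclic subdigraph.
AcyclicColouring : (D : Digraph) → ℕ → Set
AcyclicColouring D m =
  Σ (Fin (n D) → Fin m) λ c → ∀ (a : Fin m) → ¬ DirCycleIn D (λ v → c v ≡ a)

Dichromatic≡ : Digraph → ℕ → Set
Dichromatic≡ D m =
  AcyclicColouring D m × ¬ AcyclicColouring D (Data.Nat.pred m)
  where import Data.Nat

-- the cycle graph C_m (vertices Fin m, i ~ j iff j ≡ i+1 or i ≡ j+1 mod m);
-- used only for m ≥ 3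
cycleGraph : (m : ℕ) → Graph (suc (suc (suc m)))
cycleGraph m i j =
  ⌊ Data.Nat._≟_ (toℕ j) (suc (toℕ i) % suc (suc (suc m))) ⌋ ∨
  ⌊ Data.Nat._≟_ (toℕ i) (suc (toℕ j) % suc (suc (suc m))) ⌋
  where import Data.Nat

completeGraph : (m : ℕ) → Graph m
completeGraph m i j = not ⌊ i ≟ j ⌋

-- G has a connected component isomorphic to the connected graph H:
-- an injective f : V(H) → V(G) that is an isomorphism onto the induced
-- subgraph on its image, whose image is closed under G-adjacency.
-- (Since H is connected, the image is then exactly a connected component.)
HasComponentIso : {m h : ℕ} → Graph m → Graph h → Set
HasComponentIso {m} {h} G H =
  Σ (Fin h → Fin m) λ f →
    Injective _≡_ _≡_ f ×
    (∀ i j → G (f i) (f j) ≡ H i j) ×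
    (∀ i v → G (f i) v ≡ true → ∃[ j ] f j ≡ v)

-- Proper colourings of the backedge graph D^≺ are acyclic colourings of D, because inside a
-- colour class every arc goes forward in ≺.  So D^≺ has maximum degree k but is not
-- k-colourable, and the theorem is Brooks' theorem for D^≺.
--
-- For k ≠ 2, every vertex set is shown k-colourable by induction, unless some vertex and its k
-- neighbours form a clique (which is then a K_{k+1} component).  A vertex with fewer than k
-- neighbours in the set is coloured last; otherwise some vertex v has two non-adjacent
-- neighbours u and w, and Lovász's idea applies: colour u and w alike, so that v keeps a spare
-- colour and the component of v in the rest can be coloured greedily towards v.  Colourability
-- of a set is not decided here, so the induction runs in the double-negation monad; this is
-- enough because the existence of a clique is decidable.
--
-- For k = 2, an uncolourable set contains one in which every vertex has two neighbours.  Walking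
-- through it without turning back finds a cycle, which is either odd (the component sought) or
-- even, and then it is 2-coloured by parity and removed.

module Submission where

open import Data.Bool using (Bool; true; false; _∧_; _∨_; if_then_else_)
import Data.Bool as Bool
open import Data.Bool.Properties using (∨-comm; T-≡)
open import Data.Empty using (⊥-elim)
open import Data.Fin using (Fin; zero; suc; toℕ; fromℕ; fromℕ<; inject₁; _≟_)
open import Data.Fin.Permutation using (_⟨$⟩ʳ_; _⟨$⟩ˡ_; inverseˡ)
open import Data.Fin.Permutation.Components using (transpose; transpose-inverse)
open import Data.Fin.Properties
  using (any?; all?; suc-injective; 0≢1+n; toℕ<n; toℕ-fromℕ<; toℕ-injective; pigeonhole)
open import Data.Fin.Subset
  using (Subset; inside; outside; _∈_; _∉_; _⊆_; _⊂_; ⁅_⁆; _∩_; _∪_; _─_; _-_; ∣_∣; Empty)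
  renaming (⊤ to Full; ⊥ to ∅)
open import Data.Fin.Subset.Induction using (⊂-wellFounded)
open import Data.Fin.Subset.Properties
  using ( _∈?_; nonempty?; ∈⊤; x∈⁅x⁆; x∈⁅y⁆⇒x≡y; x∈p∩q⁺; x∈p∩q⁻; x∈p∪q⁺; x∈p∪q⁻; p∩q⊆p; p∩q⊆q
        ; x∈p∧x≢y⇒x∈p-y; x∈p∧x∉q⇒x∈p─q; ⊆-⊂-trans; p─q⊆p; x∈p⇒p-x⊂p; x∈p⇒∣p-x∣<∣p∣
        ; p⊆q⇒∣p∣≤∣q∣; p⊂q⇒∣p∣<∣q∣; ∣⊤∣≡n; ∣⊥∣≡0; ∣⁅x⁆∣≡1; Empty-unique; drop-there )
import Data.List as List
open import Data.List.Properties using (map-tabulate)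
open import Data.Nat using (ℕ; zero; suc; pred; _+_; _*_; _%_; _≤_; _<_; z≤n; s≤s; s<s⁻¹; NonZero; >-nonZero)
import Data.Nat as ℕ
open import Data.Nat.DivMod using (m%n<n; n%n≡0; m<n⇒m%n≡m)
open import Data.Nat.Induction using (<-rec)
open import Data.Nat.ListAction using (sum)
open import Data.Nat.Properties
  using ( ≤-refl; ≤-trans; ≤-reflexive; ≤-antisym; ≤-pred; <-trans; <-≤-trans; ≤-<-trans; <⇒≤; <⇒≱; ≮⇒≥
        ; ≤∧≢⇒<; <-cmp; _<?_; <⇒<ᵇ; n<1+n; suc-pred; m≤m+n; +-comm; +-identityʳ; +-suc; +-mono-≤
        ; +-cancelˡ-≤; *-suc; m≤m⊔n; m≤n⊔m; module ≤-Reasoning )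
open import Data.Product using (Σ; ∃; ∃-syntax; _×_; _,_; proj₁; proj₂)
open import Data.Sum using (_⊎_; inj₁; inj₂; [_,_])
import Data.Sum as Sum
open import Data.Vec using ([]; _∷_; here; there; tabulate)
open import Data.Vec.Functional using (updateAt)
open import Data.Vec.Functional.Properties using (updateAt-updates; updateAt-minimal)
open import Effect.Monad using (RawMonad)
open import Function using (_∘_; const; id)
open import Function.Bundles using (Equivalence)
open import Function.Definitions using (Injective)
open import Induction.WellFounded using (module All)
open import Level using (0ℓ)
open import Relation.Binary.Definitions using (tri<; tri≈; tri>)
open import Relation.Binary.PropositionalEquality hiding ([_])
open import Relation.Nullary using (¬_; Dec; yes; no; does)
open import Relation.Nullary.Decidable
  using (¬¬-excluded-middle; dec-true; dec-false; _×-dec_; _⊎-dec_; _→-dec_; ¬?)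
open import Relation.Nullary.Negation using (¬¬-Monad)

open import Defs hiding (n)

open RawMonad (¬¬-Monad {0ℓ}) using (_>>=_; pure)

variable
  n m k : ℕ
  x y z : Fin n
  p q : Subset n

-- Vertex sets

⊂-induction : (P : Subset n → Set) → (∀ p → (∀ {q} → q ⊂ p → P q) → P p) → ∀ p → P p
⊂-induction P = All.wfRec ⊂-wellFounded _ P

x∈p─q⇒x∉q : x ∈ p ─ q → x ∉ q
x∈p─q⇒x∉q {x = zero} {q = outside ∷ q} _ = λ ()
x∈p─q⇒x∉q {x = zero} {p = _ ∷ _} {q = inside ∷ q} ()
x∈p─q⇒x∉q {x = suc x} {p = _ ∷ p} {_ ∷ q} (there x∈p─q) = x∈p─q⇒x∉q x∈p─q ∘ drop-there

x∈p-y⇒x≢y : x ∈ p - y → x ≢ y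
x∈p-y⇒x≢y {x = x} x∈p-y refl = x∈p─q⇒x∉q x∈p-y (x∈⁅x⁆ x)

∈-tabulate⁺ : {f : Fin n → Bool} → f x ≡ true → x ∈ tabulate f
∈-tabulate⁺ {x = zero} {f} fx = subst (λ b → zero ∈ b ∷ tabulate (f ∘ suc)) (sym fx) here
∈-tabulate⁺ {x = suc x} fx = there (∈-tabulate⁺ fx)

∈-tabulate⁻ : {f : Fin n → Bool} → x ∈ tabulate f → f x ≡ true
∈-tabulate⁻ {x = zero} {f} x∈ with f zero | x∈
... | true | here = refl
∈-tabulate⁻ {x = suc x} (there x∈) = ∈-tabulate⁻ x∈

∩-monoˡ-⊆ : (r : Subset n) → p ⊆ q → p ∩ r ⊆ q ∩ r
∩-monoˡ-⊆ {p = p} r p⊆q x∈p∩r = let x∈p , x∈r = x∈p∩q⁻ p r x∈p∩r in x∈p∩q⁺ (p⊆q x∈p , x∈r)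

∣p∪q∣+∣p∩q∣≡∣p∣+∣q∣ : (p q : Subset n) → ∣ p ∪ q ∣ + ∣ p ∩ q ∣ ≡ ∣ p ∣ + ∣ q ∣
∣p∪q∣+∣p∩q∣≡∣p∣+∣q∣ [] [] = refl
∣p∪q∣+∣p∩q∣≡∣p∣+∣q∣ (outside ∷ p) (outside ∷ q) = ∣p∪q∣+∣p∩q∣≡∣p∣+∣q∣ p q
∣p∪q∣+∣p∩q∣≡∣p∣+∣q∣ (inside ∷ p) (outside ∷ q) = cong suc (∣p∪q∣+∣p∩q∣≡∣p∣+∣q∣ p q)
∣p∪q∣+∣p∩q∣≡∣p∣+∣q∣ (outside ∷ p) (inside ∷ q) =
  trans (cong suc (∣p∪q∣+∣p∩q∣≡∣p∣+∣q∣ p q)) (sym (+-suc ∣ p ∣ ∣ q ∣))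
∣p∪q∣+∣p∩q∣≡∣p∣+∣q∣ (inside ∷ p) (inside ∷ q) = cong suc (begin
  ∣ p ∪ q ∣ + suc ∣ p ∩ q ∣    ≡⟨ +-suc ∣ p ∪ q ∣ ∣ p ∩ q ∣ ⟩
  suc (∣ p ∪ q ∣ + ∣ p ∩ q ∣)  ≡⟨ cong suc (∣p∪q∣+∣p∩q∣≡∣p∣+∣q∣ p q) ⟩
  suc (∣ p ∣ + ∣ q ∣)          ≡⟨ +-suc ∣ p ∣ ∣ q ∣ ⟨
  ∣ p ∣ + suc ∣ q ∣            ∎)
  where open ≡-Reasoning

∣p∪q∣≤∣p∣+∣q∣ : (p q : Subset n) → ∣ p ∪ q ∣ ≤ ∣ p ∣ + ∣ q ∣
∣p∪q∣≤∣p∣+∣q∣ p q = ≤-trans (m≤m+n _ _) (≤-reflexive (∣p∪q∣+∣p∩q∣≡∣p∣+∣q∣ p q))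

disjoint⇒∣p∣+∣q∣≤∣r∣ : {p q r : Subset n} → p ⊆ r → q ⊆ r → (∀ {x} → x ∈ p → x ∉ q) →
                       ∣ p ∣ + ∣ q ∣ ≤ ∣ r ∣
disjoint⇒∣p∣+∣q∣≤∣r∣ {n} {p} {q} {r} p⊆r q⊆r disjoint = begin
  ∣ p ∣ + ∣ q ∣                ≡⟨ ∣p∪q∣+∣p∩q∣≡∣p∣+∣q∣ p q ⟨
  ∣ p ∪ q ∣ + ∣ p ∩ q ∣        ≡⟨ cong (λ s → ∣ p ∪ q ∣ + ∣ s ∣) (Empty-unique p∩q-empty) ⟩
  ∣ p ∪ q ∣ + ∣ ∅ {n} ∣        ≡⟨ cong (∣ p ∪ q ∣ +_) (∣⊥∣≡0 n) ⟩
  ∣ p ∪ q ∣ + 0                ≡⟨ +-identityʳ _ ⟩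
  ∣ p ∪ q ∣                    ≤⟨ p⊆q⇒∣p∣≤∣q∣ ([ p⊆r , q⊆r ] ∘ x∈p∪q⁻ p q) ⟩
  ∣ r ∣                        ∎
  where
  open ≤-Reasoning
  p∩q-empty : Empty (p ∩ q)
  p∩q-empty (x , x∈p∩q) = let x∈p , x∈q = x∈p∩q⁻ p q x∈p∩q in disjoint x∈p x∈q

∣p∩q∣<∣q∣ : (p : Subset n) → y ∈ q → y ∉ p → ∣ p ∩ q ∣ < ∣ q ∣
∣p∩q∣<∣q∣ {q = q} p y∈q y∉p = p⊂q⇒∣p∣<∣q∣ (p∩q⊆q p q , _ , y∈q , y∉p ∘ p∩q⊆p p q)

∣p-y∩q∣≤∣p∩q∣ : (p q : Subset n) (y : Fin n) → ∣ (p - y) ∩ q ∣ ≤ ∣ p ∩ q ∣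
∣p-y∩q∣≤∣p∩q∣ p q y = p⊆q⇒∣p∣≤∣q∣ (∩-monoˡ-⊆ q (p─q⊆p p ⁅ y ⁆))

∣p-y∩q∣<∣p∩q∣ : (p q : Subset n) → y ∈ p → y ∈ q → ∣ (p - y) ∩ q ∣ < ∣ p ∩ q ∣
∣p-y∩q∣<∣p∩q∣ {y = y} p q y∈p y∈q =
  p⊂q⇒∣p∣<∣q∣ ( ∩-monoˡ-⊆ q (p─q⊆p p ⁅ y ⁆) , y , x∈p∩q⁺ (y∈p , y∈q)
               , λ y∈p-y∩q → x∈p-y⇒x≢y (proj₁ (x∈p∩q⁻ (p - y) q y∈p-y∩q)) refl )

∣p∣≤1+∣p-x∣ : (p : Subset n) (x : Fin n) → ∣ p ∣ ≤ suc ∣ p - x ∣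
∣p∣≤1+∣p-x∣ p x = begin
  ∣ p ∣                   ≤⟨ p⊆q⇒∣p∣≤∣q∣ p⊆p-x∪x ⟩
  ∣ (p - x) ∪ ⁅ x ⁆ ∣     ≤⟨ ∣p∪q∣≤∣p∣+∣q∣ (p - x) ⁅ x ⁆ ⟩
  ∣ p - x ∣ + ∣ ⁅ x ⁆ ∣   ≡⟨ cong (∣ p - x ∣ +_) (∣⁅x⁆∣≡1 x) ⟩
  ∣ p - x ∣ + 1           ≡⟨ +-comm ∣ p - x ∣ 1 ⟩
  suc ∣ p - x ∣           ∎
  where
  open ≤-Reasoning
  p⊆p-x∪x : p ⊆ (p - x) ∪ ⁅ x ⁆
  p⊆p-x∪x {y} y∈p with y ≟ x
  ... | yes refl = x∈p∪q⁺ (inj₂ (x∈⁅x⁆ y))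
  ... | no y≢x = x∈p∪q⁺ (inj₁ (x∈p∧x≢y⇒x∈p-y y∈p y≢x))

two-elements⇒2≤∣p∣ : x ∈ p → y ∈ p → x ≢ y → 2 ≤ ∣ p ∣
two-elements⇒2≤∣p∣ {x = x} {p = p} x∈p y∈p x≢y =
  ≤-trans (s≤s (≤-<-trans z≤n (x∈p⇒∣p-x∣<∣p∣ (x∈p∧x≢y⇒x∈p-y y∈p (x≢y ∘ sym))))) (x∈p⇒∣p-x∣<∣p∣ x∈p)

injection⇒≤∣p∣ : (f : Fin m → Fin n) → Injective _≡_ _≡_ f → (∀ i → f i ∈ p) → m ≤ ∣ p ∣
injection⇒≤∣p∣ {m = zero} f f-inj f∈p = z≤n
injection⇒≤∣p∣ {m = suc m} {p = p} f f-inj f∈p = begin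
  suc m                  ≤⟨ s≤s (injection⇒≤∣p∣ (f ∘ suc) (suc-injective ∘ f-inj) f∘suc∈p-f0) ⟩
  suc ∣ p - f zero ∣     ≤⟨ x∈p⇒∣p-x∣<∣p∣ (f∈p zero) ⟩
  ∣ p ∣                  ∎
  where
  open ≤-Reasoning
  f∘suc∈p-f0 : ∀ i → f (suc i) ∈ p - f zero
  f∘suc∈p-f0 i = x∈p∧x≢y⇒x∈p-y (f∈p (suc i)) (0≢1+n ∘ sym ∘ f-inj)

record Enumeration (p : Subset n) : Set where
  field
    elem       : Fin ∣ p ∣ → Fin n
    injective  : Injective _≡_ _≡_ elem
    elem∈      : ∀ i → elem i ∈ p
    surjective : ∀ {x} → x ∈ p → ∃[ i ] elem i ≡ x

enumerate : (p : Subset n) → Enumeration p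
enumerate [] = record { elem = λ () ; injective = λ {} ; elem∈ = λ () ; surjective = λ () }
enumerate (outside ∷ p) = record
  { elem = suc ∘ elem ; injective = injective ∘ suc-injective ; elem∈ = there ∘ elem∈ ; surjective = surj }
  where
  open Enumeration (enumerate p)
  surj : ∀ {x} → x ∈ outside ∷ p → ∃[ i ] suc (elem i) ≡ x
  surj (there x∈p) = let i , eq = surjective x∈p in i , cong suc eq
enumerate (inside ∷ p) = record { elem = elem′ ; injective = inj ; elem∈ = elem∈′ ; surjective = surj }
  where
  open Enumeration (enumerate p)
  elem′ : Fin (suc ∣ p ∣) → Fin _
  elem′ zero = zero
  elem′ (suc i) = suc (elem i)
  inj : Injective _≡_ _≡_ elem′
  inj {zero} {zero} _ = refl
  inj {suc i} {suc j} eq = cong suc (injective (suc-injective eq))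
  elem∈′ : ∀ i → elem′ i ∈ inside ∷ p
  elem∈′ zero = here
  elem∈′ (suc i) = there (elem∈ i)
  surj : ∀ {x} → x ∈ inside ∷ p → ∃[ i ] elem′ i ≡ x
  surj here = zero , refl
  surj (there x∈p) = let i , eq = surjective x∈p in suc i , cong suc eq

¬¬-comprehension : (P : Fin n → Set) → ¬ ¬ (Σ (Subset n) λ p → (∀ {x} → x ∈ p → P x) × (∀ {x} → P x → x ∈ p))
¬¬-comprehension {zero} P = pure ([] , (λ ()) , λ { {()} })
¬¬-comprehension {suc n} P = do
  p , p⁻ , p⁺ ← ¬¬-comprehension (P ∘ suc)
  P0? ← ¬¬-excluded-middle
  pure (extend P0? p p⁻ p⁺)
  where
  extend : Dec (P zero) → (p : Subset n) → (∀ {x} → x ∈ p → P (suc x)) → (∀ {x} → P (suc x) → x ∈ p) →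
           Σ (Subset (suc n)) λ p → (∀ {x} → x ∈ p → P x) × (∀ {x} → P x → x ∈ p)
  extend (yes P0) p p⁻ p⁺ =
    inside ∷ p , (λ { here → P0 ; (there x∈p) → p⁻ x∈p }) , λ { {zero} _ → here ; {suc x} Px → there (p⁺ Px) }
  extend (no ¬P0) p p⁻ p⁺ =
    outside ∷ p , (λ { (there x∈p) → p⁻ x∈p }) , λ { {zero} P0 → ⊥-elim (¬P0 P0) ; {suc x} Px → there (p⁺ Px) }

-- Graphs and colourings

record SimpleGraph (n : ℕ) : Set where
  field
    N           : Fin n → Subset n
    symmetric   : ∀ {x y} → y ∈ N x → x ∈ N y
    irreflexive : ∀ {x} → x ∉ N x

open SimpleGraph using (symmetric; irreflexive) renaming (N to N[_])

variable
  G H : SimpleGraph n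

adjacent⇒≢ : (G : SimpleGraph n) → y ∈ N[ G ] x → x ≢ y
adjacent⇒≢ G y∈Nx refl = irreflexive G y∈Nx

module FromRelation (E : Fin n → Fin n → Set) (E? : ∀ x y → Dec (E x y))
                    (E-sym : ∀ {x y} → E x y → E y x) (E-irr : ∀ {x} → ¬ E x x) where

  adjacency : Fin n → Subset n
  adjacency x = tabulate (does ∘ E? x)

  adjacency⁺ : E x y → y ∈ adjacency x
  adjacency⁺ {x} {y} e = ∈-tabulate⁺ (dec-true (E? x y) e)

  adjacency⁻ : y ∈ adjacency x → E x y
  adjacency⁻ {y} {x} y∈ with E? x y | ∈-tabulate⁻ {f = does ∘ E? x} y∈
  ... | yes e | _ = e

  graph : SimpleGraph n
  graph = record
    { N = adjacency
    ; symmetric = adjacency⁺ ∘ E-sym ∘ adjacency⁻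
    ; irreflexive = E-irr ∘ adjacency⁻
    }

record ComponentIso (G : SimpleGraph n) {h : ℕ} (H : Graph h) : Set where
  field
    embed     : Fin h → Fin n
    injective : Injective _≡_ _≡_ embed
    adjacent⁺ : ∀ i j → H i j ≡ true → embed j ∈ N[ G ] (embed i)
    adjacent⁻ : ∀ i j → embed j ∈ N[ G ] (embed i) → H i j ≡ true
    closed    : ∀ i {y} → y ∈ N[ G ] (embed i) → ∃[ j ] embed j ≡ y

record Proper (G : SimpleGraph n) (p : Subset n) (c : Fin n → Fin k) : Set where
  constructor proper
  field
    distinct : ∀ {x y} → x ∈ p → y ∈ p → y ∈ N[ G ] x → c x ≢ c y

open Proper

Colourable : ℕ → SimpleGraph n → Subset n → Set
Colourable {n} k G p = Σ (Fin n → Fin k) (Proper G p)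

module _ {c : Fin n → Fin k} where

  proper-⊆ : q ⊆ p → Proper G p c → Proper G q c
  proper-⊆ q⊆p c-proper = proper λ x∈q y∈q → distinct c-proper (q⊆p x∈q) (q⊆p y∈q)

  proper-subgraph : (∀ {x y} → x ∈ p → y ∈ p → y ∈ N[ H ] x → y ∈ N[ G ] x) → Proper G p c → Proper H p c
  proper-subgraph H⊆G c-proper = proper λ x∈p y∈p y∈Nx → distinct c-proper x∈p y∈p (H⊆G x∈p y∈p y∈Nx)

  proper-∘ : {π : Fin k → Fin m} → Injective _≡_ _≡_ π → Proper G p c → Proper G p (π ∘ c)
  proper-∘ π-inj c-proper = proper λ x∈p y∈p y∈Nx → distinct c-proper x∈p y∈p y∈Nx ∘ π-inj

  proper-updateAt : {a : Fin k} → Proper G (p - x) c → (∀ {y} → y ∈ p - x → y ∈ N[ G ] x → c y ≢ a) →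
                    Proper G p (updateAt c x (const a))
  proper-updateAt {G = G} {p} {x} {a} c-proper a-free = proper λ y∈p z∈p z∈Ny → distinct′ y∈p z∈p z∈Ny
    where
    distinct′ : ∀ {y z} → y ∈ p → z ∈ p → z ∈ N[ G ] y → updateAt c x (const a) y ≢ updateAt c x (const a) z
    distinct′ {y} {z} y∈p z∈p z∈Ny with y ≟ x | z ≟ x
    ... | yes refl | yes refl = ⊥-elim (irreflexive G z∈Ny)
    ... | yes refl | no z≢x = λ eq → a-free (x∈p∧x≢y⇒x∈p-y z∈p z≢x) z∈Ny
                                            (trans (sym (updateAt-minimal z x c z≢x)) (trans (sym eq) (updateAt-updates x c)))
    ... | no y≢x | yes refl = λ eq → a-free (x∈p∧x≢y⇒x∈p-y y∈p y≢x) (symmetric G z∈Ny)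
                                            (trans (sym (updateAt-minimal y z c y≢x)) (trans eq (updateAt-updates z c)))
    ... | no y≢x | no z≢x = λ eq → distinct c-proper (x∈p∧x≢y⇒x∈p-y y∈p y≢x) (x∈p∧x≢y⇒x∈p-y z∈p z≢x) z∈Ny
                                            (trans (sym (updateAt-minimal y x c y≢x)) (trans eq (updateAt-minimal z x c z≢x)))

transpose-injective : (i j : Fin k) → Injective _≡_ _≡_ (transpose i j)
transpose-injective i j {a} {b} eq =
  trans (sym (transpose-inverse j i)) (trans (cong (transpose j i) eq) (transpose-inverse j i))

transpose-at-i : (i j : Fin k) → transpose i j i ≡ j
transpose-at-i i j rewrite dec-true (i ≟ i) refl = refl

transpose-other : (i j : Fin k) {a : Fin k} → a ≢ i → a ≢ j → transpose i j a ≡ a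
transpose-other i j {a} a≢i a≢j rewrite dec-false (a ≟ i) a≢i | dec-false (a ≟ j) a≢j = refl

recolour-two : {a b a′ b′ : Fin k} → a ≢ b → a′ ≢ b′ →
               ∃[ π ] Injective _≡_ _≡_ π × π a ≡ a′ × π b ≡ b′
recolour-two {a = a} {b} {a′} {b′} a≢b a′≢b′ =
    transpose (π₁ b) b′ ∘ π₁ , transpose-injective a a′ ∘ transpose-injective (π₁ b) b′
  , πa≡a′ , transpose-at-i (π₁ b) b′
  where
  π₁ : Fin _ → Fin _
  π₁ = transpose a a′
  π₁b≢a′ : π₁ b ≢ a′
  π₁b≢a′ eq = a≢b (transpose-injective a a′ (trans (transpose-at-i a a′) (sym eq)))
  πa≡a′ : transpose (π₁ b) b′ (π₁ a) ≡ a′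
  πa≡a′ = trans (cong (transpose (π₁ b) b′) (transpose-at-i a a′))
                (transpose-other (π₁ b) b′ (π₁b≢a′ ∘ sym) a′≢b′)

free-colour : (c : Fin n → Fin k) (q : Subset n) (L : Subset k) → ∣ q ∣ < ∣ L ∣ →
              ∃[ a ] a ∈ L × (∀ {y} → y ∈ q → c y ≢ a)
free-colour {n} {k} c q L ∣q∣<∣L∣ with any? (λ a → a ∈? L ×-dec all? (λ y → y ∈? q →-dec ¬? (c y ≟ a)))
... | yes (a , a∈L , a-free) = a , a∈L , λ {y} → a-free y
... | no no-free = ⊥-elim (<⇒≱ ∣q∣<∣L∣ (injection⇒≤∣p∣ g g-injective g∈q))
  where
  open Enumeration (enumerate L)
  vertex-of : ∀ a → a ∈ L → ∃[ y ] y ∈ q × c y ≡ a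
  vertex-of a a∈L with any? (λ y → y ∈? q ×-dec c y ≟ a)
  ... | yes found = found
  ... | no none = ⊥-elim (no-free (a , a∈L , λ y y∈q eq → none (y , y∈q , eq)))
  g : Fin ∣ L ∣ → Fin n
  g i = proj₁ (vertex-of (elem i) (elem∈ i))
  g∈q : ∀ i → g i ∈ q
  g∈q i = proj₁ (proj₂ (vertex-of (elem i) (elem∈ i)))
  c∘g : ∀ i → c (g i) ≡ elem i
  c∘g i = proj₂ (proj₂ (vertex-of (elem i) (elem∈ i)))
  g-injective : Injective _≡_ _≡_ g
  g-injective {i} {j} eq = injective (trans (sym (c∘g i)) (trans (cong c eq) (c∘g j)))

colourable-─ : ∣ p ∩ N[ G ] x ∣ < k → Colourable k G (p - x) → Colourable k G p
colourable-─ {p = p} {G = G} {x = x} {k = k} low (c , c-proper) =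
  updateAt c x (const a) , proper-updateAt {p = p} {x = x} c-proper (λ y∈p-x y∈Nx → a-free (x∈p∩q⁺ (y∈p-x , y∈Nx)))
  where
  fewer : ∣ (p - x) ∩ N[ G ] x ∣ < ∣ Full {k} ∣
  fewer = ≤-<-trans (∣p-y∩q∣≤∣p∩q∣ p (N[ G ] x) x) (<-≤-trans low (≤-reflexive (sym (∣⊤∣≡n k))))
  a : Fin k
  a = proj₁ (free-colour c _ Full fewer)
  a-free : ∀ {y} → y ∈ (p - x) ∩ N[ G ] x → c y ≢ a
  a-free = proj₂ (proj₂ (free-colour c _ Full fewer))

MinDegree≥ : ℕ → SimpleGraph n → Subset n → Set
MinDegree≥ k G p = ∀ {x} → x ∈ p → k ≤ ∣ p ∩ N[ G ] x ∣

record UncolourableCore (k : ℕ) (G : SimpleGraph n) (p : Subset n) : Set where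
  field
    core         : Subset n
    core⊆        : core ⊆ p
    uncolourable : ¬ Colourable k G core
    min-degree   : MinDegree≥ k G core

uncolourable⇒core : ¬ Colourable k G p → UncolourableCore k G p
uncolourable⇒core {k = k} {G = G} {p = p} = ⊂-induction (λ p → ¬ Colourable k G p → UncolourableCore k G p) step p
  where
  step : ∀ p → (∀ {q} → q ⊂ p → ¬ Colourable k G q → UncolourableCore k G q) →
         ¬ Colourable k G p → UncolourableCore k G p
  step p IH ¬col with any? (λ x → x ∈? p ×-dec ∣ p ∩ N[ G ] x ∣ <? k)
  ... | yes (x , x∈p , low) = record { core = core ; core⊆ = p─q⊆p p ⁅ x ⁆ ∘ core⊆
                                     ; uncolourable = uncolourable ; min-degree = min-degree }
    where open UncolourableCore (IH (x∈p⇒p-x⊂p x∈p) (¬col ∘ colourable-─ low))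
  ... | no none = record
    { core = p ; core⊆ = λ x∈p → x∈p ; uncolourable = ¬col
    ; min-degree = λ x∈p → ≮⇒≥ λ low → none (_ , x∈p , low) }

min-degree⇒closed : (∀ x → ∣ N[ G ] x ∣ ≤ k) → MinDegree≥ k G p → x ∈ p → N[ G ] x ⊆ p
min-degree⇒closed {G = G} {k = k} {p = p} Δ≤k δ≥k x∈p {y} y∈Nx with y ∈? p
... | yes y∈p = y∈p
... | no y∉p = ⊥-elim (<⇒≱ (<-≤-trans (∣p∩q∣<∣q∣ p y∈Nx y∉p) (Δ≤k _)) (δ≥k x∈p))

glue : {G : SimpleGraph n} {p q r : Subset n} {cq cr : Fin n → Fin k} →
       Proper G q cq → Proper G r cr → (∀ {x} → x ∈ q → x ∈ r → cq x ≡ cr x) →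
       (∀ {x y} → x ∈ p → y ∈ p → y ∈ N[ G ] x → (x ∈ q × y ∈ q) ⊎ (x ∈ r × y ∈ r)) →
       Proper G p (λ x → if does (x ∈? q) then cq x else cr x)
glue {n} {k} {G} {p} {q} {r} {cq} {cr} cq-proper cr-proper agree edges =
  proper λ x∈p y∈p y∈Nx → distinct′ (edges x∈p y∈p y∈Nx) y∈Nx
  where
  glued : Fin n → Fin k
  glued x = if does (x ∈? q) then cq x else cr x
  glued-q : ∀ {x} → x ∈ q → glued x ≡ cq x
  glued-q {x} x∈q rewrite dec-true (x ∈? q) x∈q = refl
  glued-r : ∀ {x} → x ∈ r → glued x ≡ cr x
  glued-r {x} x∈r with x ∈? q
  ... | yes x∈q = agree x∈q x∈r
  ... | no _ = refl
  distinct′ : ∀ {x y} → (x ∈ q × y ∈ q) ⊎ (x ∈ r × y ∈ r) → y ∈ N[ G ] x → glued x ≢ glued y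
  distinct′ (inj₁ (x∈q , y∈q)) y∈Nx eq =
    distinct cq-proper x∈q y∈q y∈Nx (trans (sym (glued-q x∈q)) (trans eq (glued-q y∈q)))
  distinct′ (inj₂ (x∈r , y∈r)) y∈Nx eq =
    distinct cr-proper x∈r y∈r y∈Nx (trans (sym (glued-r x∈r)) (trans eq (glued-r y∈r)))

data Path (G : SimpleGraph n) (p : Subset n) : Fin n → Fin n → Set where
  stop : Path G p x x
  step : y ∈ N[ G ] x → y ∈ p → Path G p y z → Path G p x z

path-end∈ : x ∈ p → Path G p x y → y ∈ p
path-end∈ x∈p stop = x∈p
path-end∈ _ (step _ y∈p path) = path-end∈ y∈p path

module GreedyListColouring (G : SimpleGraph n) (L : Fin n → Subset k) (c₀ : Fin n → Fin k) where

  Slack : Subset n → Fin n → Set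
  Slack p x = ∣ p ∩ N[ G ] x ∣ < ∣ L x ∣

  ReachesSlack : Subset n → Fin n → Set
  ReachesSlack p x = ∃[ s ] Slack p s × Path G p x s

  DegreeBounded : Subset n → Set
  DegreeBounded p = ∀ {x} → x ∈ p → ∣ p ∩ N[ G ] x ∣ ≤ ∣ L x ∣

  ListColouring : Subset n → Set
  ListColouring p = Σ (Fin n → Fin k) λ c → (∀ {x} → x ∈ p → c x ∈ L x) × Proper G p c

  degreeBounded-─ : DegreeBounded p → DegreeBounded (p - y)
  degreeBounded-─ {p = p} {y = y} bounded {x} x∈p-y =
    ≤-trans (∣p-y∩q∣≤∣p∩q∣ p (N[ G ] x) y) (bounded (p─q⊆p p ⁅ y ⁆ x∈p-y))

  -- A path to a vertex with slack either avoids the removed vertex s, or it passes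
  -- through s, and then the vertex just before s gains slack.
  reachesSlack-─ : {s : Fin n} → DegreeBounded p → s ∈ p → x ∈ p - s → ReachesSlack p x → ReachesSlack (p - s) x
  reachesSlack-─ {p = p} {s = s} bounded s∈p x∈p-s (t , t-slack , path) = along x∈p-s path
    where
    along : ∀ {x} → x ∈ p - s → Path G p x t → ReachesSlack (p - s) x
    along _ stop = t , ≤-<-trans (∣p-y∩q∣≤∣p∩q∣ p (N[ G ] t) s) t-slack , stop
    along {x} x∈p-s (step {y = y} y∈Nx y∈p path) with y ≟ s
    ... | yes refl = x , <-≤-trans (∣p-y∩q∣<∣p∩q∣ p (N[ G ] x) y∈p y∈Nx) (bounded (p─q⊆p p ⁅ s ⁆ x∈p-s)) , stop
    ... | no y≢s = let t′ , t′-slack , path′ = along y∈p-s path in t′ , t′-slack , step y∈Nx y∈p-s path′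
      where
      y∈p-s : y ∈ p - s
      y∈p-s = x∈p∧x≢y⇒x∈p-y y∈p y≢s

  -- A vertex with slack is coloured last.
  list-colouring : ∀ p → DegreeBounded p → (∀ {x} → x ∈ p → ReachesSlack p x) → ListColouring p
  list-colouring = ⊂-induction (λ p → DegreeBounded p → (∀ {x} → x ∈ p → ReachesSlack p x) → ListColouring p) colour
    where
    colour : ∀ p → (∀ {q} → q ⊂ p → DegreeBounded q → (∀ {x} → x ∈ q → ReachesSlack q x) → ListColouring q) →
             DegreeBounded p → (∀ {x} → x ∈ p → ReachesSlack p x) → ListColouring p
    colour p IH bounded reaches with nonempty? p
    ... | no empty = c₀ , (λ x∈p → ⊥-elim (empty (_ , x∈p))) , proper λ x∈p → ⊥-elim (empty (_ , x∈p))
    ... | yes (x , x∈p) = updateAt c s (const a) , updated∈L , proper-updateAt {p = p} {x = s} c-proper a-free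
      where
      s : Fin n
      s = proj₁ (reaches x∈p)
      s-slack : Slack p s
      s-slack = proj₁ (proj₂ (reaches x∈p))
      s∈p : s ∈ p
      s∈p = path-end∈ x∈p (proj₂ (proj₂ (reaches x∈p)))
      rest : ListColouring (p - s)
      rest = IH (x∈p⇒p-x⊂p s∈p) (degreeBounded-─ bounded)
                λ y∈p-s → reachesSlack-─ bounded s∈p y∈p-s (reaches (p─q⊆p p ⁅ s ⁆ y∈p-s))
      c = proj₁ rest
      c-proper = proj₂ (proj₂ rest)
      free = free-colour c ((p - s) ∩ N[ G ] s) (L s) (≤-<-trans (∣p-y∩q∣≤∣p∩q∣ p (N[ G ] s) s) s-slack)
      a = proj₁ free
      a-free : ∀ {y} → y ∈ p - s → y ∈ N[ G ] s → c y ≢ a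
      a-free y∈p-s y∈Ns = proj₂ (proj₂ free) (x∈p∩q⁺ (y∈p-s , y∈Ns))
      updated∈L : ∀ {y} → y ∈ p → updateAt c s (const a) y ∈ L y
      updated∈L {y} y∈p with y ≟ s
      ... | yes refl = subst (_∈ L y) (sym (updateAt-updates y c)) (proj₁ (proj₂ free))
      ... | no y≢s = subst (_∈ L y) (sym (updateAt-minimal y s c y≢s)) (proj₁ (proj₂ rest) (x∈p∧x≢y⇒x∈p-y y∈p y≢s))

module Merge (G : SimpleGraph n) (u w : Fin n) (w∉Nu : w ∉ N[ G ] u) where

  Edge : Fin n → Fin n → Set
  Edge x y = y ∈ N[ G ] x ⊎ (x ≡ u × y ∈ N[ G ] w) ⊎ (y ≡ u × x ∈ N[ G ] w)

  edge? : ∀ x y → Dec (Edge x y)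
  edge? x y = y ∈? N[ G ] x ⊎-dec (x ≟ u ×-dec y ∈? N[ G ] w) ⊎-dec (y ≟ u ×-dec x ∈? N[ G ] w)

  edge-sym : Edge x y → Edge y x
  edge-sym (inj₁ y∈Nx) = inj₁ (symmetric G y∈Nx)
  edge-sym (inj₂ (inj₁ x≡u,y∈Nw)) = inj₂ (inj₂ x≡u,y∈Nw)
  edge-sym (inj₂ (inj₂ y≡u,x∈Nw)) = inj₂ (inj₁ y≡u,x∈Nw)

  edge-irr : ¬ Edge x x
  edge-irr (inj₁ x∈Nx) = irreflexive G x∈Nx
  edge-irr (inj₂ (inj₁ (refl , u∈Nw))) = w∉Nu (symmetric G u∈Nw)
  edge-irr (inj₂ (inj₂ (refl , u∈Nw))) = w∉Nu (symmetric G u∈Nw)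

  open FromRelation Edge edge? edge-sym edge-irr public using (graph; adjacency⁺; adjacency⁻)

  redirect : Fin n → Fin n
  redirect x = if does (x ≟ w) then u else x

  redirect-w : redirect w ≡ u
  redirect-w rewrite dec-true (w ≟ w) refl = refl

  redirect-≢ : x ≢ w → redirect x ≡ x
  redirect-≢ {x} x≢w rewrite dec-false (x ≟ w) x≢w = refl

  proper-merge : {c : Fin n → Fin k} → Proper G p c → w ∈ p → c u ≡ c w → Proper graph p c
  proper-merge {p = p} {c = c} c-proper w∈p cu≡cw =
    proper λ x∈p y∈p y∈N′x → distinct′ x∈p y∈p (adjacency⁻ y∈N′x)
    where
    distinct′ : ∀ {x y} → x ∈ p → y ∈ p → Edge x y → c x ≢ c y
    distinct′ x∈p y∈p (inj₁ y∈Nx) = distinct c-proper x∈p y∈p y∈Nx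
    distinct′ x∈p y∈p (inj₂ (inj₁ (refl , y∈Nw))) = distinct c-proper w∈p y∈p y∈Nw ∘ trans (sym cu≡cw)
    distinct′ x∈p y∈p (inj₂ (inj₂ (refl , x∈Nw))) =
      λ eq → distinct c-proper w∈p x∈p x∈Nw (trans (sym cu≡cw) (sym eq))

  proper-unmerge : {c : Fin n → Fin k} → u ∈ p → Proper graph p c → Proper G (p ∪ ⁅ w ⁆) (c ∘ redirect)
  proper-unmerge {p = p} u∈p c-proper =
    proper λ x∈ y∈ y∈Nx → distinct c-proper (redirect∈ x∈) (redirect∈ y∈) (adjacency⁺ (edge y∈Nx))
    where
    redirect∈ : ∀ {x} → x ∈ p ∪ ⁅ w ⁆ → redirect x ∈ p
    redirect∈ {x} x∈ with x ≟ w
    ... | yes _ = u∈p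
    ... | no x≢w = [ (λ x∈p → x∈p) , ⊥-elim ∘ x≢w ∘ x∈⁅y⁆⇒x≡y w ] (x∈p∪q⁻ p ⁅ w ⁆ x∈)
    edge : ∀ {x y} → y ∈ N[ G ] x → Edge (redirect x) (redirect y)
    edge {x} {y} y∈Nx with x ≟ w | y ≟ w
    ... | yes refl | yes refl = ⊥-elim (irreflexive G y∈Nx)
    ... | yes refl | no _ = inj₂ (inj₁ (refl , y∈Nx))
    ... | no _ | yes refl = inj₂ (inj₂ (refl , symmetric G y∈Nx))
    ... | no _ | no _ = inj₁ y∈Nx

  merge-away-from-u : x ≢ u → y ≢ u → y ∈ N[ graph ] x → y ∈ N[ G ] x
  merge-away-from-u x≢u y≢u y∈N′x with adjacency⁻ y∈N′x
  ... | inj₁ y∈Nx = y∈Nx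
  ... | inj₂ (inj₁ (x≡u , _)) = ⊥-elim (x≢u x≡u)
  ... | inj₂ (inj₂ (y≡u , _)) = ⊥-elim (y≢u y≡u)

  merge-N-u : y ∈ N[ graph ] u → y ∈ N[ G ] u ⊎ y ∈ N[ G ] w
  merge-N-u y∈N′u with adjacency⁻ y∈N′u
  ... | inj₁ y∈Nu = inj₁ y∈Nu
  ... | inj₂ (inj₁ (_ , y∈Nw)) = inj₂ y∈Nw
  ... | inj₂ (inj₂ (refl , u∈Nw)) = ⊥-elim (w∉Nu (symmetric G u∈Nw))

module AddEdge (G : SimpleGraph n) (u w : Fin n) (u≢w : u ≢ w) where

  Edge : Fin n → Fin n → Set
  Edge x y = y ∈ N[ G ] x ⊎ (x ≡ u × y ≡ w) ⊎ (x ≡ w × y ≡ u)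

  edge? : ∀ x y → Dec (Edge x y)
  edge? x y = y ∈? N[ G ] x ⊎-dec (x ≟ u ×-dec y ≟ w) ⊎-dec (x ≟ w ×-dec y ≟ u)

  edge-sym : Edge x y → Edge y x
  edge-sym (inj₁ y∈Nx) = inj₁ (symmetric G y∈Nx)
  edge-sym (inj₂ (inj₁ (x≡u , y≡w))) = inj₂ (inj₂ (y≡w , x≡u))
  edge-sym (inj₂ (inj₂ (x≡w , y≡u))) = inj₂ (inj₁ (y≡u , x≡w))

  edge-irr : ¬ Edge x x
  edge-irr (inj₁ x∈Nx) = irreflexive G x∈Nx
  edge-irr (inj₂ (inj₁ (refl , refl))) = u≢w refl
  edge-irr (inj₂ (inj₂ (refl , refl))) = u≢w refl

  open FromRelation Edge edge? edge-sym edge-irr public using (graph; adjacency⁺; adjacency⁻)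

  w∈N′u : w ∈ N[ graph ] u
  w∈N′u = adjacency⁺ (inj₂ (inj₁ (refl , refl)))

  addEdge-away-from : ∀ {z} → z ≡ u ⊎ z ≡ w → x ≢ z → y ≢ z → y ∈ N[ graph ] x → y ∈ N[ G ] x
  addEdge-away-from z∈uw x≢z y≢z y∈N′x with adjacency⁻ y∈N′x | z∈uw
  ... | inj₁ y∈Nx | _ = y∈Nx
  ... | inj₂ (inj₁ (refl , _)) | inj₁ refl = ⊥-elim (x≢z refl)
  ... | inj₂ (inj₁ (_ , refl)) | inj₂ refl = ⊥-elim (y≢z refl)
  ... | inj₂ (inj₂ (_ , refl)) | inj₁ refl = ⊥-elim (y≢z refl)
  ... | inj₂ (inj₂ (refl , _)) | inj₂ refl = ⊥-elim (x≢z refl)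

  addEdge-N-u : y ∈ N[ graph ] u → y ∈ N[ G ] u ⊎ y ≡ w
  addEdge-N-u y∈N′u with adjacency⁻ y∈N′u
  ... | inj₁ y∈Nu = inj₁ y∈Nu
  ... | inj₂ (inj₁ (_ , y≡w)) = inj₂ y≡w
  ... | inj₂ (inj₂ (u≡w , _)) = ⊥-elim (u≢w u≡w)

  addEdge-N-w : y ∈ N[ graph ] w → y ∈ N[ G ] w ⊎ y ≡ u
  addEdge-N-w y∈N′w with adjacency⁻ y∈N′w
  ... | inj₁ y∈Nw = inj₁ y∈Nw
  ... | inj₂ (inj₁ (w≡u , _)) = ⊥-elim (u≢w (sym w≡u))
  ... | inj₂ (inj₂ (_ , y≡u)) = inj₂ y≡u

-- Brooks' theorem

CliqueAt : ℕ → SimpleGraph n → Fin n → Set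
CliqueAt k G v = ∣ N[ G ] v ∣ ≡ k × (∀ a b → a ∈ N[ G ] v → b ∈ N[ G ] v → a ≢ b → b ∈ N[ G ] a)

cliqueAt? : (k : ℕ) (G : SimpleGraph n) (v : Fin n) → Dec (CliqueAt k G v)
cliqueAt? k G v = ∣ N[ G ] v ∣ ℕ.≟ k ×-dec
  all? λ a → all? λ b → a ∈? N[ G ] v →-dec (b ∈? N[ G ] v →-dec (¬? (a ≟ b) →-dec b ∈? N[ G ] a))

-- Colourings are total functions, so even the empty set needs some colouring Fin n → Fin k.
default-colouring : {G : SimpleGraph n} → (∀ x → ∣ N[ G ] x ∣ ≤ k) → ¬ ∃ (CliqueAt k G) → Fin n → Fin k
default-colouring {k = suc k} _ _ = const zero
default-colouring {zero} {k = zero} _ _ = λ ()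
default-colouring {suc n} {k = zero} Δ≤0 no-clique =
  ⊥-elim (no-clique (zero , ≤-antisym (Δ≤0 zero) z≤n , λ a _ a∈N0 _ _ →
    ⊥-elim (<⇒≱ (≤-<-trans z≤n (x∈p⇒∣p-x∣<∣p∣ a∈N0)) (Δ≤0 zero))))

module Brooks (G : SimpleGraph n) (Δ≤k : ∀ x → ∣ N[ G ] x ∣ ≤ k) (c₀ : Fin n → Fin k) where

  ColourableBelow : Subset n → Set
  ColourableBelow S = ∀ {T} → T ⊂ S → ¬ ¬ Colourable k G T

  core-meets : ∀ {S T z} → ColourableBelow S → T ⊂ S → ¬ Colourable k H T →
               (∀ {x y} → x ≢ z → y ≢ z → y ∈ N[ H ] x → y ∈ N[ G ] x) → ¬ ¬ (z ∈ T)
  core-meets {T = T} {z} below T⊂S ¬col H≈G z∉T = below T⊂S λ (c , c-proper) →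
    ¬col (c , proper-subgraph (λ x∈T y∈T → H≈G (avoid x∈T) (avoid y∈T)) c-proper)
    where
    avoid : ∀ {x} → x ∈ T → x ≢ z
    avoid x∈T refl = z∉T x∈T

  -- R is the component of v in U = S - u - w.  B = R ∪ {u, w} is coloured greedily towards v,
  -- with u and w sharing a colour.  The rest A = (U ─ R) ∪ {u, w} meets B only in u and w, so a
  -- colouring of A glues with it after permuting colours, provided u and w are alike in both or
  -- distinct in both.  Alike in A: colour A with w merged into u.  Distinct in both: colour B
  -- with the edge uw added.  If neither works, the uncolourable cores of the two modified graphs
  -- give u and w at least k neighbours in U ─ R together, but at most one each: so k ≤ 2.
  module NonadjacentNeighbours
    (S : Subset n) (below : ColourableBelow S) (3≤k : 3 ≤ k)
    {v u w : Fin n} (v∈S : v ∈ S) (u∈S : u ∈ S) (w∈S : w ∈ S)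
    (u∈Nv : u ∈ N[ G ] v) (w∈Nv : w ∈ N[ G ] v) (u≢w : u ≢ w) (w∉Nu : w ∉ N[ G ] u)
    (R : Subset n) (R⁻ : ∀ {x} → x ∈ R → x ∈ S - u - w × Path G (S - u - w) x v)
    (R⁺ : ∀ {x} → x ∈ S - u - w → Path G (S - u - w) x v → x ∈ R)
    where

    U C A′ A B : Subset n
    U = S - u - w
    C = U ─ R
    A′ = C ∪ ⁅ u ⁆
    A = A′ ∪ ⁅ w ⁆
    B = R ∪ ⁅ u ⁆ ∪ ⁅ w ⁆

    module M = Merge G u w w∉Nu
    module P = AddEdge G u w u≢w

    U⁺ : x ∈ S → x ≢ u → x ≢ w → x ∈ U
    U⁺ x∈S x≢u x≢w = x∈p∧x≢y⇒x∈p-y (x∈p∧x≢y⇒x∈p-y x∈S x≢u) x≢w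

    U⊆S : U ⊆ S
    U⊆S = p─q⊆p S ⁅ u ⁆ ∘ p─q⊆p (S - u) ⁅ w ⁆

    U-≢u : x ∈ U → x ≢ u
    U-≢u = x∈p-y⇒x≢y ∘ p─q⊆p (S - u) ⁅ w ⁆

    U-≢w : x ∈ U → x ≢ w
    U-≢w = x∈p-y⇒x≢y

    R⊆U : R ⊆ U
    R⊆U = proj₁ ∘ R⁻

    v∈R : v ∈ R
    v∈R = R⁺ (U⁺ v∈S (adjacent⇒≢ G u∈Nv) (adjacent⇒≢ G w∈Nv)) stop

    u∉R : u ∉ R
    u∉R u∈R = U-≢u (R⊆U u∈R) refl

    w∉R : w ∉ R
    w∉R w∈R = U-≢w (R⊆U w∈R) refl

    R-closed : x ∈ R → y ∈ U → y ∈ N[ G ] x → y ∈ R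
    R-closed x∈R y∈U y∈Nx = R⁺ y∈U (step (symmetric G y∈Nx) (R⊆U x∈R) (proj₂ (R⁻ x∈R)))

    C⊆U : C ⊆ U
    C⊆U = p─q⊆p U R

    u∈A′ : u ∈ A′
    u∈A′ = x∈p∪q⁺ (inj₂ (x∈⁅x⁆ u))

    A′⊆A : A′ ⊆ A
    A′⊆A = x∈p∪q⁺ ∘ inj₁

    w∈A : w ∈ A
    w∈A = x∈p∪q⁺ (inj₂ (x∈⁅x⁆ w))

    R⊆B : R ⊆ B
    R⊆B = x∈p∪q⁺ ∘ inj₁

    u∈B : u ∈ B
    u∈B = x∈p∪q⁺ (inj₂ (x∈p∪q⁺ (inj₁ (x∈⁅x⁆ u))))

    w∈B : w ∈ B
    w∈B = x∈p∪q⁺ (inj₂ (x∈p∪q⁺ (inj₂ (x∈⁅x⁆ w))))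

    A′-cases : x ∈ A′ → x ∈ C ⊎ x ≡ u
    A′-cases x∈A′ with x∈p∪q⁻ C ⁅ u ⁆ x∈A′
    ... | inj₁ x∈C = inj₁ x∈C
    ... | inj₂ x∈⁅u⁆ = inj₂ (x∈⁅y⁆⇒x≡y u x∈⁅u⁆)

    A-cases : x ∈ A → x ∈ C ⊎ x ≡ u ⊎ x ≡ w
    A-cases x∈A with x∈p∪q⁻ A′ ⁅ w ⁆ x∈A
    ... | inj₁ x∈A′ = Sum.map₂ inj₁ (A′-cases x∈A′)
    ... | inj₂ x∈⁅w⁆ = inj₂ (inj₂ (x∈⁅y⁆⇒x≡y w x∈⁅w⁆))

    B-cases : x ∈ B → x ∈ R ⊎ x ≡ u ⊎ x ≡ w
    B-cases x∈B with x∈p∪q⁻ R (⁅ u ⁆ ∪ ⁅ w ⁆) x∈B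
    ... | inj₁ x∈R = inj₁ x∈R
    ... | inj₂ x∈uw = inj₂ (Sum.map (x∈⁅y⁆⇒x≡y u) (x∈⁅y⁆⇒x≡y w) (x∈p∪q⁻ ⁅ u ⁆ ⁅ w ⁆ x∈uw))

    S-cases : x ∈ S → x ∈ A ⊎ x ∈ R
    S-cases {x} x∈S with x ≟ u | x ≟ w | x ∈? R
    ... | yes refl | _ | _ = inj₁ (A′⊆A u∈A′)
    ... | no _ | yes refl | _ = inj₁ w∈A
    ... | no _ | no _ | yes x∈R = inj₂ x∈R
    ... | no x≢u | no x≢w | no x∉R = inj₁ (A′⊆A (x∈p∪q⁺ (inj₁ (x∈p∧x∉q⇒x∈p─q (U⁺ x∈S x≢u x≢w) x∉R))))

    B∉C : x ∈ B → x ∉ C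
    B∉C x∈B x∈C with B-cases x∈B
    ... | inj₁ x∈R = x∈p─q⇒x∉q x∈C x∈R
    ... | inj₂ (inj₁ refl) = U-≢u (C⊆U x∈C) refl
    ... | inj₂ (inj₂ refl) = U-≢w (C⊆U x∈C) refl

    A∩B : x ∈ A → x ∈ B → x ≡ u ⊎ x ≡ w
    A∩B x∈A x∈B with A-cases x∈A
    ... | inj₁ x∈C = ⊥-elim (B∉C x∈B x∈C)
    ... | inj₂ x≡u⊎w = x≡u⊎w

    A⊂S : A ⊂ S
    A⊂S = A⊆S , v , v∈S , v∉A
      where
      A⊆S : A ⊆ S
      A⊆S x∈A with A-cases x∈A
      ... | inj₁ x∈C = U⊆S (C⊆U x∈C)
      ... | inj₂ (inj₁ refl) = u∈S
      ... | inj₂ (inj₂ refl) = w∈S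
      v∉A : v ∉ A
      v∉A v∈A with A-cases v∈A
      ... | inj₁ v∈C = x∈p─q⇒x∉q v∈C v∈R
      ... | inj₂ (inj₁ v≡u) = adjacent⇒≢ G u∈Nv v≡u
      ... | inj₂ (inj₂ v≡w) = adjacent⇒≢ G w∈Nv v≡w

    B⊆S : B ⊆ S
    B⊆S x∈B with B-cases x∈B
    ... | inj₁ x∈R = U⊆S (R⊆U x∈R)
    ... | inj₂ (inj₁ refl) = u∈S
    ... | inj₂ (inj₂ refl) = w∈S

    R-neighbour∈B : x ∈ S → y ∈ R → x ∈ N[ G ] y → x ∈ B
    R-neighbour∈B {x} x∈S y∈R x∈Ny with x ≟ u | x ≟ w
    ... | yes refl | _ = u∈B
    ... | no _ | yes refl = w∈B
    ... | no x≢u | no x≢w = R⊆B (R-closed y∈R (U⁺ x∈S x≢u x≢w) x∈Ny)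

    glue-AB : {cA cB : Fin n → Fin k} → Proper G A cA → Proper G B cB → cA u ≡ cB u → cA w ≡ cB w →
              Colourable k G S
    glue-AB {cA} {cB} cA-proper cB-proper u-agrees w-agrees = _ , glue cA-proper cB-proper agree edge
      where
      agree : ∀ {x} → x ∈ A → x ∈ B → cA x ≡ cB x
      agree x∈A x∈B with A∩B x∈A x∈B
      ... | inj₁ refl = u-agrees
      ... | inj₂ refl = w-agrees
      edge : ∀ {x y} → x ∈ S → y ∈ S → y ∈ N[ G ] x → (x ∈ A × y ∈ A) ⊎ (x ∈ B × y ∈ B)
      edge x∈S y∈S y∈Nx with S-cases x∈S | S-cases y∈S
      ... | inj₁ x∈A | inj₁ y∈A = inj₁ (x∈A , y∈A)
      ... | inj₂ x∈R | _ = inj₂ (R⊆B x∈R , R-neighbour∈B y∈S x∈R y∈Nx)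
      ... | inj₁ _ | inj₂ y∈R = inj₂ (R-neighbour∈B x∈S y∈R (symmetric G y∈Nx) , R⊆B y∈R)

    a₀ : Fin k
    a₀ = fromℕ< (<-≤-trans (s≤s z≤n) 3≤k)

    Touches : Fin n → Set
    Touches x = u ∈ N[ G ] x ⊎ w ∈ N[ G ] x

    -- The colours allowed in R: a₀ is reserved for u and w.
    L : Fin n → Subset k
    L x with u ∈? N[ G ] x ⊎-dec w ∈? N[ G ] x
    ... | yes _ = Full - a₀
    ... | no _ = Full

    L-avoids : {b : Fin k} → Touches x → b ∈ L x → b ≢ a₀
    L-avoids {x} touches b∈L with u ∈? N[ G ] x ⊎-dec w ∈? N[ G ] x
    ... | yes _ = x∈p-y⇒x≢y b∈L
    ... | no untouched = ⊥-elim (untouched touches)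

    k≤1+∣Full-a₀∣ : k ≤ suc ∣ Full - a₀ ∣
    k≤1+∣Full-a₀∣ = ≤-trans (≤-reflexive (sym (∣⊤∣≡n k))) (∣p∣≤1+∣p-x∣ Full a₀)

    module LC = GreedyListColouring G L c₀

    degree-bounded : LC.DegreeBounded R
    degree-bounded {x} x∈R with u ∈? N[ G ] x ⊎-dec w ∈? N[ G ] x
    ... | yes (inj₁ u∈Nx) = ≤-pred (≤-trans (<-≤-trans (∣p∩q∣<∣q∣ R u∈Nx u∉R) (Δ≤k x)) k≤1+∣Full-a₀∣)
    ... | yes (inj₂ w∈Nx) = ≤-pred (≤-trans (<-≤-trans (∣p∩q∣<∣q∣ R w∈Nx w∉R) (Δ≤k x)) k≤1+∣Full-a₀∣)
    ... | no _ = ≤-trans (p⊆q⇒∣p∣≤∣q∣ (p∩q⊆q R _)) (≤-trans (Δ≤k x) (≤-reflexive (sym (∣⊤∣≡n k))))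

    v-slack : LC.Slack R v
    v-slack with u ∈? N[ G ] v ⊎-dec w ∈? N[ G ] v
    ... | no untouched = ⊥-elim (untouched (inj₁ u∈Nv))
    ... | yes _ = ≤-pred (≤-trans (s≤s R∩Nv<Nv-u) (≤-trans (x∈p⇒∣p-x∣<∣p∣ u∈Nv) (≤-trans (Δ≤k v) k≤1+∣Full-a₀∣)))
      where
      R∩Nv<Nv-u : ∣ R ∩ N[ G ] v ∣ < ∣ N[ G ] v - u ∣
      R∩Nv<Nv-u = p⊂q⇒∣p∣<∣q∣
        ( (λ y∈ → let y∈R , y∈Nv = x∈p∩q⁻ R _ y∈ in x∈p∧x≢y⇒x∈p-y y∈Nv (U-≢u (R⊆U y∈R)))
        , w , x∈p∧x≢y⇒x∈p-y w∈Nv (u≢w ∘ sym) , w∉R ∘ p∩q⊆p R _ )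

    path-in-R : Path G U x v → Path G R x v
    path-in-R stop = stop
    path-in-R (step y∈Nx y∈U path) = step y∈Nx (R⁺ y∈U path) (path-in-R path)

    R-listColouring : LC.ListColouring R
    R-listColouring = LC.list-colouring R degree-bounded λ x∈R → v , v-slack , path-in-R (proj₂ (R⁻ x∈R))

    cR : Fin n → Fin k
    cR = proj₁ R-listColouring

    cB : Fin n → Fin k
    cB = updateAt (updateAt cR u (const a₀)) w (const a₀)

    cB-u : cB u ≡ a₀
    cB-u = trans (updateAt-minimal u w _ u≢w) (updateAt-updates u cR)

    cB-w : cB w ≡ a₀
    cB-w = updateAt-updates w _

    cB-proper : Proper G B cB
    cB-proper = proper-updateAt {p = B} {x = w} (proper-updateAt {p = B - w} {x = u} (proper-⊆ B-w-u⊆R cR-proper) u-free) w-free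
      where
      cR-proper = proj₂ (proj₂ R-listColouring)
      B-w-u⊆R : B - w - u ⊆ R
      B-w-u⊆R {y} y∈ with B-cases (p─q⊆p B ⁅ w ⁆ (p─q⊆p (B - w) ⁅ u ⁆ y∈))
      ... | inj₁ y∈R = y∈R
      ... | inj₂ (inj₁ refl) = ⊥-elim (x∈p-y⇒x≢y y∈ refl)
      ... | inj₂ (inj₂ refl) = ⊥-elim (x∈p-y⇒x≢y (p─q⊆p (B - w) ⁅ u ⁆ y∈) refl)
      listed : ∀ {y} → y ∈ R → Touches y → cR y ≢ a₀
      listed y∈R touches = L-avoids touches (proj₁ (proj₂ R-listColouring) y∈R)
      u-free : ∀ {y} → y ∈ B - w - u → y ∈ N[ G ] u → cR y ≢ a₀
      u-free y∈ y∈Nu = listed (B-w-u⊆R y∈) (inj₁ (symmetric G y∈Nu))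
      w-free : ∀ {y} → y ∈ B - w → y ∈ N[ G ] w → updateAt cR u (const a₀) y ≢ a₀
      w-free {y} y∈ y∈Nw = subst (_≢ a₀) (sym (updateAt-minimal y u cR y≢u))
                                 (listed (B-w-u⊆R (x∈p∧x≢y⇒x∈p-y y∈ y≢u)) (inj₂ (symmetric G y∈Nw)))
        where
        y≢u : y ≢ u
        y≢u refl = w∉Nu (symmetric G y∈Nw)

    S⊆B : Empty C → S ⊆ B
    S⊆B C-empty x∈S with S-cases x∈S
    ... | inj₂ x∈R = R⊆B x∈R
    ... | inj₁ x∈A with A-cases x∈A
    ...   | inj₁ x∈C = ⊥-elim (C-empty (_ , x∈C))
    ...   | inj₂ (inj₁ refl) = u∈B
    ...   | inj₂ (inj₂ refl) = w∈B

    via-merge : Colourable k M.graph A′ → Colourable k G S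
    via-merge (c , c-proper) = glue-AB cA-proper cB-proper (trans cA-u (sym cB-u)) (trans cA-w (sym cB-w))
      where
      π : Fin k → Fin k
      π = transpose (c u) a₀
      cA-proper : Proper G A (π ∘ c ∘ M.redirect)
      cA-proper = M.proper-unmerge u∈A′ (proper-∘ (transpose-injective (c u) a₀) c-proper)
      cA-u : π (c (M.redirect u)) ≡ a₀
      cA-u = trans (cong (π ∘ c) (M.redirect-≢ u≢w)) (transpose-at-i (c u) a₀)
      cA-w : π (c (M.redirect w)) ≡ a₀
      cA-w = trans (cong (π ∘ c) M.redirect-w) (transpose-at-i (c u) a₀)

    via-addEdge : ¬ Colourable k M.graph A′ → Colourable k P.graph B → ¬ ¬ Colourable k G S
    via-addEdge ¬A′ (cP , cP-proper) = do
      cA , cA-proper ← below A⊂S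
      pure (matching cA cA-proper)
      where
      cPu≢cPw : cP u ≢ cP w
      cPu≢cPw = distinct cP-proper u∈B w∈B P.w∈N′u
      matching : (cA : Fin n → Fin k) → Proper G A cA → Colourable k G S
      matching cA cA-proper =
        let π , π-injective , πu , πw = recolour-two cAu≢cAw cPu≢cPw
        in glue-AB (proper-∘ π-injective cA-proper) (proper-subgraph (λ _ _ → P.adjacency⁺ ∘ inj₁) cP-proper) πu πw
        where
        cAu≢cAw : cA u ≢ cA w
        cAu≢cAw eq = ¬A′ (cA , proper-⊆ A′⊆A (M.proper-merge cA-proper w∈A eq))

    merge-core-degree : ¬ Colourable k M.graph A′ → ¬ ¬ (k ≤ ∣ C ∩ N[ G ] u ∣ + ∣ C ∩ N[ G ] w ∣)
    merge-core-degree ¬A′ = do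
      u∈T ← core-meets below (⊆-⊂-trans core⊆ (⊆-⊂-trans A′⊆A A⊂S)) uncolourable M.merge-away-from-u
      pure (≤-trans (min-degree u∈T) (≤-trans (p⊆q⇒∣p∣≤∣q∣ T∩N′u⊆) (∣p∪q∣≤∣p∣+∣q∣ (C ∩ N[ G ] u) (C ∩ N[ G ] w))))
      where
      open UncolourableCore (uncolourable⇒core ¬A′)
      T∩N′u⊆ : core ∩ N[ M.graph ] u ⊆ (C ∩ N[ G ] u) ∪ (C ∩ N[ G ] w)
      T∩N′u⊆ y∈ with x∈p∩q⁻ core _ y∈
      ... | y∈T , y∈N′u with A′-cases (core⊆ y∈T)
      ...   | inj₂ refl = ⊥-elim (irreflexive M.graph y∈N′u)
      ...   | inj₁ y∈C = x∈p∪q⁺ (Sum.map (x∈p∩q⁺ ∘ (y∈C ,_)) (x∈p∩q⁺ ∘ (y∈C ,_)) (M.merge-N-u y∈N′u))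

    few-C-neighbours : ∀ {z} → k ≤ suc ∣ B ∩ N[ G ] z ∣ → ∣ C ∩ N[ G ] z ∣ ≤ 1
    few-C-neighbours {z} k≤ = +-cancelˡ-≤ ∣ B ∩ N[ G ] z ∣ _ _ (begin
      ∣ B ∩ N[ G ] z ∣ + ∣ C ∩ N[ G ] z ∣  ≤⟨ disjoint⇒∣p∣+∣q∣≤∣r∣ (p∩q⊆q B _) (p∩q⊆q C _) disjoint ⟩
      ∣ N[ G ] z ∣                         ≤⟨ Δ≤k z ⟩
      k                                    ≤⟨ k≤ ⟩
      suc ∣ B ∩ N[ G ] z ∣                 ≡⟨ +-comm 1 _ ⟩
      ∣ B ∩ N[ G ] z ∣ + 1                 ∎)
      where
      open ≤-Reasoning
      disjoint : ∀ {y} → y ∈ B ∩ N[ G ] z → y ∉ C ∩ N[ G ] z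
      disjoint y∈B∩Nz y∈C∩Nz = B∉C (p∩q⊆p B _ y∈B∩Nz) (p∩q⊆p C _ y∈C∩Nz)

    addEdge-core-degree : x ∈ C → ¬ Colourable k P.graph B → ¬ ¬ (∣ C ∩ N[ G ] u ∣ ≤ 1 × ∣ C ∩ N[ G ] w ∣ ≤ 1)
    addEdge-core-degree {x} x∈C ¬B = do
      u∈T ← core-meets below T⊂S uncolourable (P.addEdge-away-from (inj₁ refl))
      w∈T ← core-meets below T⊂S uncolourable (P.addEdge-away-from (inj₂ refl))
      pure ( few-C-neighbours (≤-trans (min-degree u∈T) (bound P.addEdge-N-u))
           , few-C-neighbours (≤-trans (min-degree w∈T) (bound P.addEdge-N-w)) )
      where
      open UncolourableCore (uncolourable⇒core ¬B)
      T⊂S : core ⊂ S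
      T⊂S = ⊆-⊂-trans core⊆ (B⊆S , x , U⊆S (C⊆U x∈C) , λ x∈B → B∉C x∈B x∈C)
      bound : ∀ {z z′} → (∀ {y} → y ∈ N[ P.graph ] z → y ∈ N[ G ] z ⊎ y ≡ z′) →
              ∣ core ∩ N[ P.graph ] z ∣ ≤ suc ∣ B ∩ N[ G ] z ∣
      bound {z} {z′} N′z⊆ = begin
        ∣ core ∩ N[ P.graph ] z ∣          ≤⟨ p⊆q⇒∣p∣≤∣q∣ T∩N′z⊆ ⟩
        ∣ (B ∩ N[ G ] z) ∪ ⁅ z′ ⁆ ∣        ≤⟨ ∣p∪q∣≤∣p∣+∣q∣ (B ∩ N[ G ] z) ⁅ z′ ⁆ ⟩
        ∣ B ∩ N[ G ] z ∣ + ∣ ⁅ z′ ⁆ ∣      ≡⟨ cong (∣ B ∩ N[ G ] z ∣ +_) (∣⁅x⁆∣≡1 z′) ⟩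
        ∣ B ∩ N[ G ] z ∣ + 1               ≡⟨ +-comm _ 1 ⟩
        suc ∣ B ∩ N[ G ] z ∣               ∎
        where
        open ≤-Reasoning
        T∩N′z⊆ : core ∩ N[ P.graph ] z ⊆ (B ∩ N[ G ] z) ∪ ⁅ z′ ⁆
        T∩N′z⊆ {y} y∈ with x∈p∩q⁻ core _ y∈
        ... | y∈T , y∈N′z with N′z⊆ y∈N′z
        ...   | inj₁ y∈Nz = x∈p∪q⁺ (inj₁ (x∈p∩q⁺ (core⊆ y∈T , y∈Nz)))
        ...   | inj₂ refl = x∈p∪q⁺ (inj₂ (x∈⁅x⁆ y))

    colourable : ¬ ¬ Colourable k G S
    colourable with nonempty? C
    ... | no C-empty = pure (cB , proper-⊆ (S⊆B C-empty) cB-proper)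
    ... | yes (x , x∈C) = do
      no ¬A′ ← ¬¬-excluded-middle {A = Colourable k M.graph A′}
        where yes A′-colourable → pure (via-merge A′-colourable)
      k≤ ← merge-core-degree ¬A′
      no ¬B ← ¬¬-excluded-middle {A = Colourable k P.graph B}
        where yes B-colourable → via-addEdge ¬A′ B-colourable
      few-u , few-w ← addEdge-core-degree x∈C ¬B
      ⊥-elim (<⇒≱ 3≤k (≤-trans k≤ (+-mono-≤ few-u few-w)))

  brooks-step : ¬ ∃ (CliqueAt k G) → k ≢ 2 → ∀ S → ColourableBelow S → ¬ ¬ Colourable k G S
  brooks-step no-clique k≢2 S below with any? (λ x → x ∈? S ×-dec ∣ S ∩ N[ G ] x ∣ <? k)
  ... | yes (x , x∈S , low) = do
    c ← below (x∈p⇒p-x⊂p x∈S)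
    pure (colourable-─ low c)
  ... | no no-low with nonempty? S
  ...   | no empty = pure (c₀ , proper λ x∈S → ⊥-elim (empty (_ , x∈S)))
  ...   | yes (v , v∈S)
          with any? (λ u → any? (λ w → u ∈? N[ G ] v ×-dec w ∈? N[ G ] v ×-dec ¬? (u ≟ w) ×-dec ¬? (w ∈? N[ G ] u)))
  ...     | no none = ⊥-elim (no-clique (v , ∣Nv∣≡k , adjacent))
    where
    ∣Nv∣≡k : ∣ N[ G ] v ∣ ≡ k
    ∣Nv∣≡k = ≤-antisym (Δ≤k v) (≤-trans (≮⇒≥ λ low → no-low (v , v∈S , low)) (p⊆q⇒∣p∣≤∣q∣ (p∩q⊆q S _)))
    adjacent : ∀ a b → a ∈ N[ G ] v → b ∈ N[ G ] v → a ≢ b → b ∈ N[ G ] a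
    adjacent a b a∈Nv b∈Nv a≢b with b ∈? N[ G ] a
    ... | yes b∈Na = b∈Na
    ... | no b∉Na = ⊥-elim (none (a , b , a∈Nv , b∈Nv , a≢b , b∉Na))
  ...     | yes (u , w , u∈Nv , w∈Nv , u≢w , w∉Nu) = do
    R , R⁻ , R⁺ ← ¬¬-comprehension (λ x → x ∈ S - u - w × Path G (S - u - w) x v)
    NonadjacentNeighbours.colourable S below 3≤k v∈S (closed u∈Nv) (closed w∈Nv) u∈Nv w∈Nv u≢w w∉Nu
                                     R R⁻ (λ x∈U path → R⁺ (x∈U , path))
    where
    closed : N[ G ] v ⊆ S
    closed = min-degree⇒closed {G = G} Δ≤k (λ x∈S → ≮⇒≥ λ low → no-low (_ , x∈S , low)) v∈S
    3≤k : 3 ≤ k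
    3≤k = ≤∧≢⇒< (≤-trans (two-elements⇒2≤∣p∣ u∈Nv w∈Nv u≢w) (Δ≤k v)) (k≢2 ∘ sym)

  brooks : ¬ ∃ (CliqueAt k G) → k ≢ 2 → ¬ ¬ Colourable k G Full
  brooks no-clique k≢2 = ⊂-induction (λ S → ¬ ¬ Colourable k G S) (brooks-step no-clique k≢2) Full

completeGraph-≢ : {i j : Fin m} → completeGraph m i j ≡ true → i ≢ j
completeGraph-≢ {i = i} {j} edge with i ≟ j
... | no i≢j = i≢j

≢-completeGraph : {i j : Fin m} → i ≢ j → completeGraph m i j ≡ true
≢-completeGraph {i = i} {j} i≢j with i ≟ j
... | yes i≡j = ⊥-elim (i≢j i≡j)
... | no _ = refl

-- A neighbour y of a ∈ N(v) outside N(v) ∪ {v} would give a the k + 1 neighbours y, v and N(v) - a.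
clique-closed : (∀ x → ∣ N[ G ] x ∣ ≤ k) → {v a y : Fin n} → CliqueAt k G v → a ∈ N[ G ] v → y ∈ N[ G ] a →
                y ≡ v ⊎ y ∈ N[ G ] v
clique-closed {G = G} Δ≤k {v} {a} {y} (refl , pairwise) a∈Nv y∈Na with y ≟ v | y ∈? N[ G ] v
... | yes y≡v | _ = inj₁ y≡v
... | no _ | yes y∈Nv = inj₂ y∈Nv
... | no y≢v | no y∉Nv = ⊥-elim (<⇒≱ (≤-<-trans too-many (x∈p⇒∣p-x∣<∣p∣ y∈Na)) (Δ≤k a))
  where
  open ≤-Reasoning
  Nv-a⊆ : N[ G ] v - a ⊆ N[ G ] a - y
  Nv-a⊆ {b} b∈ = x∈p∧x≢y⇒x∈p-y (pairwise a b a∈Nv (p─q⊆p _ _ b∈) (x∈p-y⇒x≢y b∈ ∘ sym))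
                               λ { refl → y∉Nv (p─q⊆p _ _ b∈) }
  v⊆ : ⁅ v ⁆ ⊆ N[ G ] a - y
  v⊆ b∈⁅v⁆ with x∈⁅y⁆⇒x≡y v b∈⁅v⁆
  ... | refl = x∈p∧x≢y⇒x∈p-y (symmetric G a∈Nv) (y≢v ∘ sym)
  v∉Nv-a : ∀ {b} → b ∈ N[ G ] v - a → b ∉ ⁅ v ⁆
  v∉Nv-a b∈ b∈⁅v⁆ with x∈⁅y⁆⇒x≡y v b∈⁅v⁆
  ... | refl = irreflexive G (p─q⊆p _ _ b∈)
  too-many : ∣ N[ G ] v ∣ ≤ ∣ N[ G ] a - y ∣
  too-many = begin
    ∣ N[ G ] v ∣                   ≤⟨ ∣p∣≤1+∣p-x∣ (N[ G ] v) a ⟩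
    suc ∣ N[ G ] v - a ∣           ≡⟨ +-comm 1 _ ⟩
    ∣ N[ G ] v - a ∣ + 1           ≡⟨ cong (∣ N[ G ] v - a ∣ +_) (∣⁅x⁆∣≡1 v) ⟨
    ∣ N[ G ] v - a ∣ + ∣ ⁅ v ⁆ ∣   ≤⟨ disjoint⇒∣p∣+∣q∣≤∣r∣ Nv-a⊆ v⊆ v∉Nv-a ⟩
    ∣ N[ G ] a - y ∣               ∎

clique⇒component : (∀ x → ∣ N[ G ] x ∣ ≤ k) → {v : Fin n} → CliqueAt k G v → ComponentIso G (completeGraph (suc k))
clique⇒component {G = G} Δ≤k {v} clique@(refl , pairwise) = record
  { embed = embed ; injective = injective′ ; adjacent⁺ = adjacent⁺ ; adjacent⁻ = adjacent⁻ ; closed = closed }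
  where
  open Enumeration (enumerate (N[ G ] v))
  embed : Fin (suc ∣ N[ G ] v ∣) → Fin _
  embed zero = v
  embed (suc i) = elem i
  injective′ : Injective _≡_ _≡_ embed
  injective′ {zero} {zero} _ = refl
  injective′ {zero} {suc j} v≡ = ⊥-elim (irreflexive G (subst (_∈ N[ G ] v) (sym v≡) (elem∈ j)))
  injective′ {suc i} {zero} ≡v = ⊥-elim (irreflexive G (subst (_∈ N[ G ] v) ≡v (elem∈ i)))
  injective′ {suc i} {suc j} eq = cong suc (injective eq)
  adjacent⁺ : ∀ i j → completeGraph _ i j ≡ true → embed j ∈ N[ G ] (embed i)
  adjacent⁺ zero zero ()
  adjacent⁺ zero (suc j) _ = elem∈ j
  adjacent⁺ (suc i) zero _ = symmetric G (elem∈ i)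
  adjacent⁺ (suc i) (suc j) edge = pairwise _ _ (elem∈ i) (elem∈ j) (completeGraph-≢ edge ∘ cong suc ∘ injective)
  adjacent⁻ : ∀ i j → embed j ∈ N[ G ] (embed i) → completeGraph _ i j ≡ true
  adjacent⁻ i j adj = ≢-completeGraph λ { refl → irreflexive G adj }
  in-N[v] : ∀ {y} → y ∈ N[ G ] v → ∃[ j ] embed j ≡ y
  in-N[v] y∈Nv = let j , eq = surjective y∈Nv in suc j , eq
  closed : ∀ i {y} → y ∈ N[ G ] (embed i) → ∃[ j ] embed j ≡ y
  closed zero y∈Nv = in-N[v] y∈Nv
  closed (suc i) y∈Na = [ (λ { refl → zero , refl }) , in-N[v] ] (clique-closed {G = G} Δ≤k clique (elem∈ i) y∈Na)

brooks-clique : (∀ x → ∣ N[ G ] x ∣ ≤ k) → k ≢ 2 → ¬ Colourable k G Full → ComponentIso G (completeGraph (suc k))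
brooks-clique {G = G} {k = k} Δ≤k k≢2 uncolourable with any? (cliqueAt? k G)
... | yes (v , clique) = clique⇒component Δ≤k clique
... | no no-clique = ⊥-elim (Brooks.brooks G Δ≤k (default-colouring {G = G} Δ≤k no-clique) no-clique k≢2 uncolourable)

-- Odd cycles

least-witness : {P : ℕ → Set} → (∀ j → Dec (P j)) → ∀ {j} → P j → ∃[ m ] P m × (∀ {i} → i < m → ¬ P i)
least-witness {P = P} P? {j} = <-rec (λ j → P j → ∃[ m ] P m × (∀ {i} → i < m → ¬ P i)) search j
  where
  search : ∀ j → (∀ {i} → i < j → P i → ∃[ m ] P m × (∀ {i} → i < m → ¬ P i)) → P j →
           ∃[ m ] P m × (∀ {i} → i < m → ¬ P i)
  search j IH Pj with any? (λ (i : Fin j) → P? (toℕ i))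
  ... | yes (i , Pi) = IH (toℕ<n i) Pi
  ... | no none = j , Pj , λ i<j Pi → none (fromℕ< i<j , subst P (sym (toℕ-fromℕ< i<j)) Pi)

parity : ℕ → Fin 2
parity zero = zero
parity (suc zero) = suc zero
parity (suc (suc a)) = parity a

parity-suc : ∀ a → parity (suc a) ≢ parity a
parity-suc zero ()
parity-suc (suc zero) ()
parity-suc (suc (suc a)) = parity-suc a

odd-form : ∀ m → parity m ≡ suc zero → ∃[ h ] m ≡ suc (2 * h)
odd-form (suc zero) _ = 0 , refl
odd-form (suc (suc m)) odd = let h , m≡ = odd-form m odd in suc h , trans (cong (2 +_) m≡) (cong ℕ.suc (sym (*-suc 2 h)))

cycleGraph⁻ : ∀ {l} {i j : Fin (3 + 2 * l)} → cycleGraph (2 * l) i j ≡ true →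
              toℕ j ≡ suc (toℕ i) % (3 + 2 * l) ⊎ toℕ i ≡ suc (toℕ j) % (3 + 2 * l)
cycleGraph⁻ {l} {i} {j} edge with toℕ j ℕ.≟ suc (toℕ i) % (3 + 2 * l) | toℕ i ℕ.≟ suc (toℕ j) % (3 + 2 * l)
... | yes j≡ | _ = inj₁ j≡
... | no _ | yes i≡ = inj₂ i≡

cycleGraph⁺ : ∀ {l} {i j : Fin (3 + 2 * l)} →
              toℕ j ≡ suc (toℕ i) % (3 + 2 * l) ⊎ toℕ i ≡ suc (toℕ j) % (3 + 2 * l) → cycleGraph (2 * l) i j ≡ true
cycleGraph⁺ {l} {i} {j} adjacent with toℕ j ℕ.≟ suc (toℕ i) % (3 + 2 * l) | toℕ i ℕ.≟ suc (toℕ j) % (3 + 2 * l)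
... | yes _ | _ = refl
... | no _ | yes _ = refl
... | no j≢ | no i≢ = ⊥-elim ([ j≢ , i≢ ] adjacent)

module DegreeTwo (G : SimpleGraph n) (Δ≤2 : ∀ x → ∣ N[ G ] x ∣ ≤ 2) where

  third-neighbour : ∀ {x y z t} → y ∈ N[ G ] x → z ∈ N[ G ] x → y ≢ z → t ∈ N[ G ] x → t ≡ y ⊎ t ≡ z
  third-neighbour {x} {y} {z} {t} y∈Nx z∈Nx y≢z t∈Nx with t ≟ y | t ≟ z
  ... | yes t≡y | _ = inj₁ t≡y
  ... | no _ | yes t≡z = inj₂ t≡z
  ... | no t≢y | no t≢z = ⊥-elim (<⇒≱ (≤-trans (s≤s 2≤) (x∈p⇒∣p-x∣<∣p∣ t∈Nx)) (Δ≤2 x))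
    where
    2≤ : 2 ≤ ∣ N[ G ] x - t ∣
    2≤ = two-elements⇒2≤∣p∣ (x∈p∧x≢y⇒x∈p-y y∈Nx (t≢y ∘ sym)) (x∈p∧x≢y⇒x∈p-y z∈Nx (t≢z ∘ sym)) y≢z

  other : Fin n → Fin n → Fin n
  other x p with any? (λ y → y ∈? N[ G ] x ×-dec ¬? (y ≟ p))
  ... | yes (y , _) = y
  ... | no _ = p

  other-spec : (x p : Fin n) → 2 ≤ ∣ N[ G ] x ∣ → other x p ∈ N[ G ] x × other x p ≢ p
  other-spec x p 2≤ with any? (λ y → y ∈? N[ G ] x ×-dec ¬? (y ≟ p))
  ... | yes (_ , spec) = spec
  ... | no none = ⊥-elim (<⇒≱ 2≤ (≤-trans (p⊆q⇒∣p∣≤∣q∣ Nx⊆⁅p⁆) (≤-reflexive (∣⁅x⁆∣≡1 p))))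
    where
    Nx⊆⁅p⁆ : N[ G ] x ⊆ ⁅ p ⁆
    Nx⊆⁅p⁆ {y} y∈Nx with y ≟ p
    ... | yes refl = x∈⁅x⁆ y
    ... | no y≢p = ⊥-elim (none (y , y∈Nx , y≢p))

  -- In a closed set of degree-2 vertices, the walk that never turns back runs around a cycle.
  module Walk (T : Subset n) (T-closed : ∀ {x} → x ∈ T → N[ G ] x ⊆ T)
              (T-degree : ∀ {x} → x ∈ T → 2 ≤ ∣ N[ G ] x ∣)
              {x₀ y₁ : Fin n} (x₀∈T : x₀ ∈ T) (y₁∈Nx₀ : y₁ ∈ N[ G ] x₀) where

    W : ℕ → Fin n
    W zero = x₀
    W (suc zero) = y₁
    W (suc (suc i)) = other (W (suc i)) (W i)

    W∈T×W-step : ∀ i → W i ∈ T × W (suc i) ∈ N[ G ] (W i)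
    W∈T×W-step zero = x₀∈T , y₁∈Nx₀
    W∈T×W-step (suc i) = W1∈T , proj₁ (other-spec _ _ (T-degree W1∈T))
      where
      W1∈T : W (suc i) ∈ T
      W1∈T = T-closed (proj₁ (W∈T×W-step i)) (proj₂ (W∈T×W-step i))

    W∈T : ∀ i → W i ∈ T
    W∈T = proj₁ ∘ W∈T×W-step

    W-step : ∀ i → W (suc i) ∈ N[ G ] (W i)
    W-step = proj₂ ∘ W∈T×W-step

    W-back : ∀ i → W i ∈ N[ G ] (W (suc i))
    W-back = symmetric G ∘ W-step

    W-turn : ∀ i → W (suc (suc i)) ≢ W i
    W-turn i = proj₂ (other-spec _ _ (T-degree (W∈T (suc i))))

    Repeats : ℕ → Set
    Repeats j = ∃[ i ] i < j × W i ≡ W j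

    repeats? : ∀ j → Dec (Repeats j)
    repeats? j with any? (λ (i : Fin j) → W (toℕ i) ≟ W j)
    ... | yes (i , eq) = yes (toℕ i , toℕ<n i , eq)
    ... | no none = no λ (i , i<j , eq) → none (fromℕ< i<j , trans (cong W (toℕ-fromℕ< i<j)) eq)

    some-repeat : ∃ Repeats
    some-repeat = let i , j , i<j , eq = pigeonhole (n<1+n n) (W ∘ toℕ) in toℕ j , toℕ i , i<j , eq

    record Cycle (m : ℕ) : Set where
      field
        3≤m       : 3 ≤ m
        closes    : W m ≡ W 0
        injective : ∀ {a b} → a < m → b < m → W a ≡ W b → a ≡ b

    -- The first repetition returns to the start: W m cannot equal a later W (suc i),
    -- which already has its two neighbours W i and W (i + 2).
    first-repeat-at-0 : ∀ {m i} → i < m → W i ≡ W m → (∀ {j} → j < m → ¬ Repeats j) → i ≡ 0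
    first-repeat-at-0 {m} {zero} _ _ _ = refl
    first-repeat-at-0 {suc m} {suc i} i<m Wi≡Wm earlier
      with third-neighbour (W-back i) (W-step (suc i)) (W-turn i ∘ sym) (subst (λ x → W m ∈ N[ G ] x) (sym Wi≡Wm) (W-back m))
    ... | inj₁ Wm≡Wi = ⊥-elim (earlier (n<1+n m) (i , s<s⁻¹ i<m , sym Wm≡Wi))
    ... | inj₂ Wm≡Wi+2 with <-cmp (suc (suc i)) m
    ...   | tri< i+2<m _ _ = ⊥-elim (earlier (n<1+n m) (suc (suc i) , i+2<m , sym Wm≡Wi+2))
    ...   | tri≈ _ refl _ = ⊥-elim (W-turn (suc i) (sym Wi≡Wm))
    ...   | tri> _ _ m<i+2 with ≤-antisym (s<s⁻¹ i<m) (≤-pred m<i+2)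
    ...     | refl = ⊥-elim (irreflexive G (subst (_∈ N[ G ] (W m)) (sym Wi≡Wm) (W-step m)))

    cycle : ∃ Cycle
    cycle with least-witness repeats? (proj₂ some-repeat)
    ... | m , (i , i<m , Wi≡Wm) , earlier =
      m , record { 3≤m = long m (≤-<-trans z≤n i<m) closes ; closes = closes ; injective = injective }
      where
      closes : W m ≡ W 0
      closes = trans (sym Wi≡Wm) (cong W (first-repeat-at-0 i<m Wi≡Wm earlier))
      long : ∀ m → 0 < m → W m ≡ W 0 → 3 ≤ m
      long (suc zero) _ W1≡W0 = ⊥-elim (irreflexive G (subst (_∈ N[ G ] x₀) W1≡W0 y₁∈Nx₀))
      long (suc (suc zero)) _ W2≡W0 = ⊥-elim (W-turn 0 W2≡W0)
      long (suc (suc (suc m))) _ _ = s≤s (s≤s (s≤s z≤n))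
      injective : ∀ {a b} → a < m → b < m → W a ≡ W b → a ≡ b
      injective {a} {b} a<m b<m eq with <-cmp a b
      ... | tri< a<b _ _ = ⊥-elim (earlier b<m (a , a<b , eq))
      ... | tri≈ _ a≡b _ = a≡b
      ... | tri> _ _ b<a = ⊥-elim (earlier a<m (b , b<a , sym eq))

    module OnCycle {m : ℕ} (cyc : Cycle m) where
      open Cycle cyc

      instance
        m-nonZero : NonZero m
        m-nonZero = >-nonZero (<-≤-trans (s≤s z≤n) 3≤m)

      next : ℕ → ℕ
      next a = suc a % m

      prev : ℕ → ℕ
      prev zero = pred m
      prev (suc a) = a

      next<m : ∀ a → next a < m
      next<m a = m%n<n (suc a) m

      prev<m : ∀ {a} → a < m → prev a < m
      prev<m {zero} _ = <-≤-trans (n<1+n (pred m)) (≤-reflexive (suc-pred m))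
      prev<m {suc a} a+1<m = <-trans (n<1+n a) a+1<m

      next-prev : ∀ {a} → a < m → next (prev a) ≡ a
      next-prev {zero} _ = trans (cong (_% m) (suc-pred m)) (n%n≡0 m)
      next-prev {suc a} a+1<m = m<n⇒m%n≡m a+1<m

      W-next : ∀ {a} → a < m → W (next a) ≡ W (suc a)
      W-next {a} a<m with <-cmp (suc a) m
      ... | tri< a+1<m _ _ = cong W (m<n⇒m%n≡m a+1<m)
      ... | tri≈ _ refl _ = trans (cong W (n%n≡0 m)) (sym closes)
      ... | tri> _ _ m<a+1 = ⊥-elim (<⇒≱ m<a+1 a<m)

      W-prev : ∀ {a} → a < m → W (prev a) ∈ N[ G ] (W a)
      W-prev {a} a<m = subst (λ x → W (prev a) ∈ N[ G ] x) W-suc-prev (W-back (prev a))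
        where
        W-suc-prev : W (suc (prev a)) ≡ W a
        W-suc-prev = trans (sym (W-next (prev<m a<m))) (cong W (next-prev a<m))

      W-next≢W-prev : ∀ {a} → a < m → W (suc a) ≢ W (prev a)
      W-next≢W-prev {zero} _ W1≡
        with injective (<-≤-trans (s≤s (s≤s z≤n)) 3≤m) (prev<m {zero} (<-≤-trans (s≤s z≤n) 3≤m)) W1≡
      ... | 1≡pred-m with subst (3 ≤_) (trans (sym (suc-pred m)) (cong ℕ.suc (sym 1≡pred-m))) 3≤m
      ...   | s≤s (s≤s ())
      W-next≢W-prev {suc a} _ = W-turn a

      neighbours : ∀ {a y} → a < m → y ∈ N[ G ] (W a) → y ≡ W (suc a) ⊎ y ≡ W (prev a)
      neighbours {a} a<m = third-neighbour (W-step a) (W-prev a<m) (W-next≢W-prev a<m)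

      Adjacent : ℕ → ℕ → Set
      Adjacent a b = b ≡ next a ⊎ a ≡ next b

      adjacent⁺ : ∀ {a b} → a < m → b < m → Adjacent a b → W b ∈ N[ G ] (W a)
      adjacent⁺ {a} a<m b<m (inj₁ refl) = subst (_∈ N[ G ] (W a)) (sym (W-next a<m)) (W-step a)
      adjacent⁺ {b = b} a<m b<m (inj₂ refl) = subst (λ x → W b ∈ N[ G ] x) (sym (W-next b<m)) (W-back b)

      adjacent⁻ : ∀ {a b} → a < m → b < m → W b ∈ N[ G ] (W a) → Adjacent a b
      adjacent⁻ {a} {b} a<m b<m Wb∈N with neighbours a<m Wb∈N
      ... | inj₁ Wb≡ = inj₁ (injective b<m (next<m a) (trans Wb≡ (sym (W-next a<m))))
      ... | inj₂ Wb≡ = inj₂ (trans (sym (next-prev a<m)) (cong next (sym (injective b<m (prev<m a<m) Wb≡))))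

      closed : ∀ {a y} → a < m → y ∈ N[ G ] (W a) → ∃[ b ] b < m × W b ≡ y
      closed {a} a<m y∈N with neighbours a<m y∈N
      ... | inj₁ refl = next a , next<m a , W-next a<m
      ... | inj₂ refl = prev a , prev<m a<m , refl

      component : ∀ {l} → m ≡ 3 + 2 * l → ComponentIso G (cycleGraph (2 * l))
      component {l} refl = record
        { embed = W ∘ toℕ
        ; injective = toℕ-injective ∘ injective (toℕ<n _) (toℕ<n _)
        ; adjacent⁺ = λ i j → adjacent⁺ (toℕ<n i) (toℕ<n j) ∘ cycleGraph⁻ {l}
        ; adjacent⁻ = λ i j → cycleGraph⁺ {l} ∘ adjacent⁻ (toℕ<n i) (toℕ<n j)
        ; closed = λ i y∈N → let b , b<m , Wb≡y = closed (toℕ<n i) y∈N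
                             in fromℕ< b<m , trans (cong W (toℕ-fromℕ< b<m)) Wb≡y
        }

      on-cycle? : (y : Fin n) → Dec (∃[ a ] W (toℕ {m} a) ≡ y)
      on-cycle? y = any? (λ a → W (toℕ a) ≟ y)

      Z : Subset n
      Z = tabulate (does ∘ on-cycle?)

      W∈Z : ∀ {a} → a < m → W a ∈ Z
      W∈Z a<m = ∈-tabulate⁺ (dec-true (on-cycle? _) (fromℕ< a<m , cong W (toℕ-fromℕ< a<m)))

      Z⁻ : ∀ {y} → y ∈ Z → ∃[ a ] a < m × W a ≡ y
      Z⁻ {y} y∈Z with on-cycle? y | ∈-tabulate⁻ {f = does ∘ on-cycle?} y∈Z
      ... | yes (a , Wa≡y) | _ = toℕ a , toℕ<n a , Wa≡y

      Z-closed : ∀ {y z} → y ∈ Z → z ∈ N[ G ] y → z ∈ Z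
      Z-closed y∈Z z∈Ny with Z⁻ y∈Z
      ... | a , a<m , refl = let b , b<m , Wb≡z = closed a<m z∈Ny in subst (_∈ Z) Wb≡z (W∈Z b<m)

      colour : Fin n → Fin 2
      colour y with on-cycle? y
      ... | yes (a , _) = parity (toℕ a)
      ... | no _ = zero

      colour-W : ∀ {a} → a < m → colour (W a) ≡ parity a
      colour-W {a} a<m with on-cycle? (W a)
      ... | yes (b , Wb≡Wa) = cong parity (injective (toℕ<n b) a<m Wb≡Wa)
      ... | no none = ⊥-elim (none (fromℕ< a<m , cong W (toℕ-fromℕ< a<m)))

      module Even (even : parity m ≡ zero) where

        parity-next : ∀ {a} → a < m → parity (next a) ≢ parity a
        parity-next {a} a<m with <-cmp (suc a) m
        ... | tri< a+1<m _ _ = subst (λ b → parity b ≢ parity a) (sym (m<n⇒m%n≡m a+1<m)) (parity-suc a)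
        ... | tri≈ _ a+1≡m _ =
          λ eq → parity-suc a (trans (cong parity a+1≡m) (trans even (trans (cong parity (sym next≡0)) eq)))
          where
          next≡0 : next a ≡ 0
          next≡0 = trans (cong (_% m) a+1≡m) (n%n≡0 m)
        ... | tri> _ _ m<a+1 = ⊥-elim (<⇒≱ m<a+1 a<m)

        Z-proper : Proper G Z colour
        Z-proper = proper distinct′
          where
          distinct′ : ∀ {y z} → y ∈ Z → z ∈ Z → z ∈ N[ G ] y → colour y ≢ colour z
          distinct′ y∈Z z∈Z z∈Ny with Z⁻ y∈Z | Z⁻ z∈Z
          ... | a , a<m , refl | b , b<m , refl with adjacent⁻ a<m b<m z∈Ny
          ...   | inj₁ refl = λ eq → parity-next a<m (trans (sym (colour-W b<m)) (trans (sym eq) (colour-W a<m)))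
          ...   | inj₂ refl = λ eq → parity-next b<m (trans (sym (colour-W a<m)) (trans eq (colour-W b<m)))

        extend-off-cycle : Colourable 2 G (T ─ Z) → Colourable 2 G T
        extend-off-cycle (c , c-proper) =
          _ , glue Z-proper c-proper (λ y∈Z y∈T─Z → ⊥-elim (x∈p─q⇒x∉q y∈T─Z y∈Z)) edge
          where
          edge : ∀ {x y} → x ∈ T → y ∈ T → y ∈ N[ G ] x → (x ∈ Z × y ∈ Z) ⊎ (x ∈ T ─ Z × y ∈ T ─ Z)
          edge {x} {y} x∈T y∈T y∈Nx with x ∈? Z | y ∈? Z
          ... | yes x∈Z | _ = inj₁ (x∈Z , Z-closed x∈Z y∈Nx)
          ... | no x∉Z | yes y∈Z = ⊥-elim (x∉Z (Z-closed y∈Z (symmetric G y∈Nx)))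
          ... | no x∉Z | no y∉Z = inj₂ (x∈p∧x∉q⇒x∈p─q x∈T x∉Z , x∈p∧x∉q⇒x∈p─q y∈T y∉Z)

  CycleComponent : Set
  CycleComponent = ∃[ l ] ComponentIso G (cycleGraph (2 * l))

  cycle-in-core : ∀ {S} → (∀ {S′} → S′ ⊂ S → ¬ Colourable 2 G S′ → CycleComponent) →
                  UncolourableCore 2 G S → CycleComponent
  cycle-in-core {S} IH record { core = T ; core⊆ = T⊆S ; uncolourable = ¬col ; min-degree = δ≥2 } with nonempty? T
  ... | no empty = ⊥-elim (¬col (const zero , proper λ x∈T → ⊥-elim (empty (_ , x∈T))))
  ... | yes (x₀ , x₀∈T) = around (proj₂ cycle)
    where
    T-degree : ∀ {x} → x ∈ T → 2 ≤ ∣ N[ G ] x ∣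
    T-degree x∈T = ≤-trans (δ≥2 x∈T) (p⊆q⇒∣p∣≤∣q∣ (p∩q⊆q T _))
    open Walk T (min-degree⇒closed {G = G} Δ≤2 δ≥2) T-degree x₀∈T (proj₁ (other-spec x₀ x₀ (T-degree x₀∈T)))
    around : ∀ {m} → Cycle m → CycleComponent
    around {m} cyc with parity m in parity-m
    ... | suc zero with odd-form m parity-m
    ...   | zero , refl = ⊥-elim (<⇒≱ (Cycle.3≤m cyc) (s≤s z≤n))
    ...   | suc l , m≡ = l , component {l} (trans m≡ (cong ℕ.suc (*-suc 2 l)))
      where open OnCycle cyc
    around {m} cyc | zero = IH off-cycle⊂S (¬col ∘ extend-off-cycle)
      where
      open OnCycle cyc
      open Even parity-m
      off-cycle⊂S : T ─ Z ⊂ S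
      off-cycle⊂S = T⊆S ∘ p─q⊆p T Z , x₀ , T⊆S x₀∈T
                  , λ x₀∈T─Z → x∈p─q⇒x∉q x₀∈T─Z (W∈Z {0} (<-≤-trans (s≤s z≤n) (Cycle.3≤m cyc)))

  odd-cycle : ∀ S → ¬ Colourable 2 G S → CycleComponent
  odd-cycle = ⊂-induction (λ S → ¬ Colourable 2 G S → CycleComponent) λ S IH → cycle-in-core IH ∘ uncolourable⇒core

-- Backedge graphs

≡true-ext : {a b : Bool} → (a ≡ true → b ≡ true) → (b ≡ true → a ≡ true) → a ≡ b
≡true-ext {false} {false} _ _ = refl
≡true-ext {false} {true} _ b⇒a = b⇒a refl
≡true-ext {true} a⇒b _ = sym (a⇒b refl)

sum-indicators : (f : Fin n → Bool) →
                 sum (List.tabulate (λ u → if f u then 1 else 0)) ≡ ∣ tabulate (does ∘ (λ u → f u Bool.≟ true)) ∣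
sum-indicators {zero} f = refl
sum-indicators {suc n} f with f zero
... | true = cong ℕ.suc (sum-indicators (f ∘ suc))
... | false = sum-indicators (f ∘ suc)

≤-foldr-⊔ : (f : Fin n → ℕ) (x : Fin n) → f x ≤ List.foldr ℕ._⊔_ 0 (List.tabulate f)
≤-foldr-⊔ f zero = m≤m⊔n _ _
≤-foldr-⊔ f (suc x) = ≤-trans (≤-foldr-⊔ (f ∘ suc) x) (m≤n⊔m _ _)

module FromBoolGraph (G : Graph n) (G-sym : ∀ x y → G x y ≡ G y x) (G-irr : ∀ x → G x x ≡ false) where

  no-loop : ∀ {x} → G x x ≢ true
  no-loop {x} Gxx≡true with trans (sym (G-irr x)) Gxx≡true
  ... | ()

  open FromRelation (λ x y → G x y ≡ true) (λ x y → G x y Bool.≟ true) (λ {x} {y} → trans (G-sym y x)) no-loop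
    public using (graph; adjacency⁺; adjacency⁻)

  maxDegree≡⇒Δ≤ : maxDegree G ≡ k → ∀ x → ∣ N[ graph ] x ∣ ≤ k
  maxDegree≡⇒Δ≤ {k} Δ≡k x = begin
    ∣ N[ graph ] x ∣                                              ≡⟨ sum-indicators (G x) ⟨
    sum (List.tabulate (λ u → if G x u then 1 else 0))       ≡⟨ cong sum (map-tabulate id (λ u → if G x u then 1 else 0)) ⟨
    degree G x                                                    ≤⟨ ≤-foldr-⊔ (degree G) x ⟩
    List.foldr ℕ._⊔_ 0 (List.tabulate (degree G))                 ≡⟨ cong (List.foldr ℕ._⊔_ 0) (map-tabulate id (degree G)) ⟨
    maxDegree G                                                   ≡⟨ Δ≡k ⟩
    k                                                             ∎
    where open ≤-Reasoning

  hasComponentIso : ∀ {h} {H : Graph h} → ComponentIso graph H → HasComponentIso G H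
  hasComponentIso c = embed , injective , (λ i j → ≡true-ext (adjacent⁻ i j ∘ adjacency⁺) (adjacency⁻ ∘ adjacent⁺ i j))
                    , λ i y → closed i ∘ adjacency⁺
    where open ComponentIso c

inject₁≢suc : (i : Fin n) → inject₁ i ≢ suc i
inject₁≢suc zero ()
inject₁≢suc (suc i) = inject₁≢suc i ∘ suc-injective

increasing⇒≤ : (q : Fin (suc n) → ℕ) → (∀ i → q (inject₁ i) < q (suc i)) → ∀ i → q zero ≤ q i
increasing⇒≤ q increasing zero = ≤-refl
increasing⇒≤ {suc n} q increasing (suc i) =
  ≤-trans (<⇒≤ (increasing zero)) (increasing⇒≤ (q ∘ suc) (increasing ∘ suc) i)

module Backedge (D : Digraph) (σ : Ordering D) where

  backedge-sym : ∀ x y → backedge D σ x y ≡ backedge D σ y x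
  backedge-sym x y = ∨-comm (arc D x y ∧ before D σ y x) _

  backedge-irr : ∀ x → backedge D σ x x ≡ false
  backedge-irr x rewrite loopless D x = refl

  open FromBoolGraph (backedge D σ) backedge-sym backedge-irr public

  position : Fin (Digraph.n D) → ℕ
  position x = toℕ (σ ⟨$⟩ʳ x)

  position-injective : Injective _≡_ _≡_ position
  position-injective {x} {y} eq = trans (sym (inverseˡ σ)) (trans (cong (σ ⟨$⟩ˡ_) (toℕ-injective eq)) (inverseˡ σ))

  forward : ∀ {x y} → arc D x y ≡ true → backedge D σ x y ≡ false → x ≢ y → position x < position y
  forward {x} {y} xy∈A not-backedge x≢y with <-cmp (position x) (position y)
  ... | tri< x<y _ _ = x<y
  ... | tri≈ _ x≡y _ = ⊥-elim (x≢y (position-injective x≡y))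
  ... | tri> _ _ y<x with Equivalence.to T-≡ (<⇒<ᵇ y<x)
  ... | before-yx rewrite xy∈A | before-yx with not-backedge
  ... | ()

  -- Within a colour class every arc goes forward, so positions would increase all around a directed cycle.
  colourable⇒acyclic : Colourable k graph Full → AcyclicColouring D k
  colourable⇒acyclic (c , c-proper) = c , no-cycle
    where
    no-cycle : ∀ a → ¬ DirCycleIn D (λ v → c v ≡ a)
    no-cycle a cyc = <⇒≱ (forward close (same-colour _ _) last≢first) (increasing⇒≤ (position ∘ vtx) increasing _)
      where
      open DirCycleIn cyc renaming (step to arc-step)
      same-colour : ∀ i j → backedge D σ (vtx i) (vtx j) ≡ false
      same-colour i j with backedge D σ (vtx i) (vtx j) in edge
      ... | false = refl
      ... | true = ⊥-elim (distinct c-proper ∈⊤ ∈⊤ (adjacency⁺ edge) (trans (inS i) (sym (inS j))))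
      increasing : ∀ i → position (vtx (inject₁ i)) < position (vtx (suc i))
      increasing i = forward (arc-step i) (same-colour _ _) (inject₁≢suc i ∘ inj)
      last≢first : vtx (fromℕ (suc len)) ≢ vtx zero
      last≢first eq with inj eq
      ... | ()

mainTheorem9 : (D : Digraph) (k : ℕ) → Degreewidth≡ D k → Dichromatic≡ D (suc k) →
    (σ : Ordering D) → maxDegree (backedge D σ) ≡ k →
    (k ≡ 2 → ∃[ l ] HasComponentIso (backedge D σ) (cycleGraph (2 * l))) ×
    (k ≢ 2 → HasComponentIso (backedge D σ) (completeGraph (suc k)))
mainTheorem9 D k _ (_ , not-k-colourable) σ Δ≡k = odd-cycle-component , complete-component
  where
  open Backedge D σ
  Δ≤k : ∀ x → ∣ N[ graph ] x ∣ ≤ k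
  Δ≤k = maxDegree≡⇒Δ≤ Δ≡k
  uncolourable : ¬ Colourable k graph Full
  uncolourable = not-k-colourable ∘ colourable⇒acyclic
  odd-cycle-component : k ≡ 2 → ∃[ l ] HasComponentIso (backedge D σ) (cycleGraph (2 * l))
  odd-cycle-component refl = let l , component = DegreeTwo.odd-cycle graph Δ≤k Full uncolourable in l , hasComponentIso component
  complete-component : k ≢ 2 → HasComponentIso (backedge D σ) (completeGraph (suc k))
  complete-component k≢2 = hasComponentIso (brooks-clique Δ≤k k≢2 uncolourable)
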